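{- For every $n\ge1$, $$|\mathrm{DA}_n(1234,2413)|=\begin{cases}F_{n/2},& n\text{ even},\\ 2,& n=5,\\ 1,&\text{otherwise}.\end{cases}$$
   Context: $(F_k)_{k\ge0}$ are the Fibonacci numbers, indexed so that $F_0=F_1=1$ and $F_k=F_{k-1}+F_{k-2}$. A permutation $\sigma\in\mathcal S_n$ contains a pattern $\pi\in\mathcal S_m$ if there are indices $i_1<\dots<i_m$ with $\sigma(i_a)<\sigma(i_b)\iff\pi(a)<\pi(b)$. A word $w$ is alternating if $w_{2i-1}<w_{2i}$ and $w_{2i}>w_{2i+1}$ whenever these indices exist. A permutation is doubly alternating if it and its inverse are alternating in one-line notation. $\mathrm{DA}_n(1234,2413)$ is the set of doubly alternating $\sigma\in\mathcal S_n$ avoiding both $1234$ and $2413$. -}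

module Defs where

open import Data.Nat as ℕ using (ℕ; zero; suc; _<_; _>_; _/_; _%_; _≡ᵇ_)
open import Data.Bool using (if_then_else_)
open import Data.Fin as Fin using (Fin; toℕ)
open import Data.Vec using (Vec; lookup; toList; map; []; _∷_)
open import Data.List as List using (List)
open import Data.Product using (Σ; ∃; _×_)
open import Data.Unit using (⊤)
open import Relation.Nullary using (¬_)
open import Relation.Binary.PropositionalEquality using (_≡_)
open import Function.Bundles using (_⇔_)

F : ℕ → ℕ
F zero = 1
F (suc zero) = 1
F (suc (suc k)) = F (suc k) ℕ.+ F k

IsPerm : {n : ℕ} → Vec (Fin n) n → Set
IsPerm {n} v = ∀ (i j : Fin n) → lookup v i ≡ lookup v j → i ≡ j

mutual
  AltUp : List ℕ → Set
  AltUp (x List.∷ y List.∷ r) = (x < y) × AltDown (y List.∷ r)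
  AltUp _ = ⊤

  AltDown : List ℕ → Set
  AltDown (x List.∷ y List.∷ r) = (x > y) × AltUp (y List.∷ r)
  AltDown _ = ⊤

Alternating : {n : ℕ} → Vec (Fin n) n → Set
Alternating v = AltUp (toList (map toℕ v))

IsInverse : {n : ℕ} → Vec (Fin n) n → Vec (Fin n) n → Set
IsInverse {n} v w = ∀ (i : Fin n) → lookup w (lookup v i) ≡ i

DoublyAlternating : {n : ℕ} → Vec (Fin n) n → Set
DoublyAlternating v = Alternating v × (∃ λ w → IsInverse v w × Alternating w)

Contains : {n m : ℕ} → Vec (Fin n) n → Vec (Fin m) m → Set
Contains {n} {m} σ π =
  ∃ λ (f : Fin m → Fin n) →
    (∀ a b → a Fin.< b → f a Fin.< f b) ×
    (∀ a b → (lookup σ (f a) Fin.< lookup σ (f b)) ⇔ (lookup π a Fin.< lookup π b))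

Avoids : {n m : ℕ} → Vec (Fin n) n → Vec (Fin m) m → Set
Avoids σ π = ¬ Contains σ π

-- patterns 1234 and 2413 (0-indexed values)
p1234 : Vec (Fin 4) 4
p1234 = Fin.zero ∷ Fin.suc Fin.zero ∷ Fin.suc (Fin.suc Fin.zero) ∷ Fin.suc (Fin.suc (Fin.suc Fin.zero)) ∷ []

p2413 : Vec (Fin 4) 4
p2413 = Fin.suc Fin.zero ∷ Fin.suc (Fin.suc (Fin.suc Fin.zero)) ∷ Fin.zero ∷ Fin.suc (Fin.suc Fin.zero) ∷ []

InDA : {n : ℕ} → Vec (Fin n) n → Set
InDA σ = IsPerm σ × DoublyAlternating σ × Avoids σ p1234 × Avoids σ p2413

expected : ℕ → ℕ
expected n = if n % 2 ≡ᵇ 0 then F (n / 2) else (if n ≡ᵇ 5 then 2 else 1)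

-- For even n the two
-- largest values must open it, either as (n−2)(n−1) or, together with n−4 and n−3, as
-- (n−4)(n−2)(n−3)(n−1): the position of n−1 is pinned down by the alternation of σ and σ⁻¹
-- and by the two forbidden patterns. Deleting the opening block leaves such a permutation of
-- length n−2 or n−4, and conversely either block can be put in front of one, so the counts
-- satisfy the Fibonacci recursion. For odd n the second entry is n−1 (the one exception being
-- 02143 for n = 5), the first is 0 by a counting and parity argument, and then the start is
-- forced to be 0 (n−1) (n−3) (n−2); deleting n−1 and n−2 gives the case n−2, so apart from
-- 02143 there is exactly one permutation.

module Submission where

open import Defs
open import Data.Bool as Bool using (Bool; true; false; not; if_then_else_)
open import Data.Bool.Properties using (not-involutive)
open import Data.Empty using (⊥; ⊥-elim)
open import Data.Fin as Fin using (Fin; toℕ; fromℕ<; #_; punchOut)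
open import Data.Fin.Properties using (toℕ-fromℕ<; toℕ-injective; toℕ<n; injective⇒≤; any?; punchOut-injective)
open import Data.List using (List; []; _∷_; length; map; _++_; drop)
open import Data.List.Membership.Propositional using (_∈_)
open import Data.List.Membership.Propositional.Properties using (∈-map⁺; ∈-map⁻; ∈-++⁺ˡ; ∈-++⁺ʳ; ∈-++⁻)
open import Data.List.Properties using (length-map; length-++; length-drop)
open import Data.List.Relation.Unary.All using ([]; _∷_)
open import Data.List.Relation.Unary.AllPairs using ([]; _∷_)
open import Data.List.Relation.Unary.Any using (here; there)
open import Data.List.Relation.Unary.Unique.Propositional using (Unique)
import Data.List.Relation.Unary.Unique.Propositional.Properties as Unique
open import Data.Nat
open import Data.Nat.DivMod using (m*n%n≡0; m*n/n≡m; [m+kn]%n≡m%n)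
open import Data.Nat.Properties
open import Data.Product using (∃; _×_; _,_; proj₁; proj₂)
open import Data.Sum using (_⊎_; inj₁; inj₂; [_,_]′)
open import Data.Unit using (tt)
open import Data.Vec as Vec using (Vec; lookup; toList; tabulate)
open import Data.Vec.Properties using (lookup∘tabulate; tabulate∘lookup; tabulate-cong)
open import Function.Base using (_∘_; case_of_)
open import Function.Bundles using (_⇔_; mk⇔; Equivalence)
open import Relation.Binary using (tri<; tri≈; tri>)
open import Relation.Binary.PropositionalEquality
open import Relation.Nullary using (Dec; yes; no; ¬_)
open import Relation.Nullary.Decidable using (True; toWitness; _→-dec_; _×-dec_; _⊎-dec_; ¬?)

-- Out-of-range lookups return the junk value 0.
nth : List ℕ → ℕ → ℕ
nth [] _ = 0
nth (x ∷ xs) zero = x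
nth (x ∷ xs) (suc i) = nth xs i

even : ℕ → Bool
even zero = true
even (suc zero) = false
even (suc (suc n)) = even n

even-suc : ∀ x → even (suc x) ≡ not (even x)
even-suc zero = refl
even-suc (suc zero) = refl
even-suc (suc (suc x)) = even-suc x

even-suc⇒odd : ∀ {x} → even (suc x) ≡ true → even x ≡ false
even-suc⇒odd {suc zero} _ = refl
even-suc⇒odd {suc (suc x)} = even-suc⇒odd {x}

odd-suc⇒even : ∀ {x} → even (suc x) ≡ false → even x ≡ true
odd-suc⇒even {zero} _ = refl
odd-suc⇒even {suc (suc x)} = odd-suc⇒even {x}

even⇒odd-suc : ∀ {x} → even x ≡ true → even (suc x) ≡ false
even⇒odd-suc {zero} _ = refl
even⇒odd-suc {suc (suc x)} = even⇒odd-suc {x}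

odd⇒even-suc : ∀ {x} → even x ≡ false → even (suc x) ≡ true
odd⇒even-suc {suc zero} _ = refl
odd⇒even-suc {suc (suc x)} = odd⇒even-suc {x}

even-+ : ∀ c x → even c ≡ true → even (c + x) ≡ even x
even-+ zero x _ = refl
even-+ (suc (suc c)) x e = even-+ c x e

double : ℕ → ℕ
double zero = 0
double (suc j) = suc (suc (double j))

even-double : ∀ j → even (double j) ≡ true
even-double zero = refl
even-double (suc j) = even-double j

UpDown : Bool → ℕ → ℕ → Set
UpDown true x y = x < y
UpDown false x y = y < x

ascent : ∀ {b x y} → b ≡ true → UpDown b x y → x < y
ascent refl o = o

descent : ∀ {b x y} → b ≡ false → UpDown b x y → y < x
descent refl o = o

UpDown-+ : ∀ {b x y} c → UpDown b x y → UpDown b (c + x) (c + y)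
UpDown-+ {true} c o = +-monoʳ-< c o
UpDown-+ {false} c o = +-monoʳ-< c o

UpDown-cancel : ∀ {b x y} c → UpDown b (c + x) (c + y) → UpDown b x y
UpDown-cancel {true} {x} {y} c o = +-cancelˡ-< c x y o
UpDown-cancel {false} {x} {y} c o = +-cancelˡ-< c y x o

<+1 : ∀ {x} → x < 1 + x
<+1 = ≤-refl
<+2 : ∀ {x} → x < 2 + x
<+2 = m≤n⇒m≤1+n <+1
<+3 : ∀ {x} → x < 3 + x
<+3 = m≤n⇒m≤1+n <+2
<+4 : ∀ {x} → x < 4 + x
<+4 = m≤n⇒m≤1+n <+3

m<1+n∧m≢n⇒m<n : ∀ {x y} → x < 1 + y → x ≢ y → x < y
m<1+n∧m≢n⇒m<n p q = ≤∧≢⇒< (≤-pred p) q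

m<2+n∧≢⇒m<n : ∀ {x y} → x < 2 + y → x ≢ y → x ≢ 1 + y → x < y
m<2+n∧≢⇒m<n p a b = m<1+n∧m≢n⇒m<n (m<1+n∧m≢n⇒m<n p b) a

m<3+n∧≢⇒m<n : ∀ {x y} → x < 3 + y → x ≢ y → x ≢ 1 + y → x ≢ 2 + y → x < y
m<3+n∧≢⇒m<n p a b c = m<2+n∧≢⇒m<n (m<1+n∧m≢n⇒m<n p c) a b

m<4+n∧≢⇒m<n : ∀ {x y} → x < 4 + y → x ≢ y → x ≢ 1 + y → x ≢ 2 + y → x ≢ 3 + y → x < y
m<4+n∧≢⇒m<n p a b c d = m<3+n∧≢⇒m<n (m<1+n∧m≢n⇒m<n p d) a b c

n<m<2+n⇒m≡1+n : ∀ {x y} → y < x → x < 2 + y → x ≡ 1 + y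
n<m<2+n⇒m≡1+n p1 p2 = ≤-antisym (≤-pred p2) p1

n<m⇒m≮1+n : ∀ {x y} → y < x → x < 1 + y → ⊥
n<m⇒m≮1+n p1 p2 = <⇒≱ p1 (≤-pred p2)

least : (P : ℕ → Set) → (∀ i → Dec (P i)) → ∀ y → P y →
        ∃ λ c → P c × c ≤ y × (∀ i → i < c → ¬ P i)
least P P? y py with leastBelow (suc y)
  where
  leastBelow : ∀ y → (∀ i → i < y → ¬ P i) ⊎ (∃ λ c → P c × c < y × (∀ i → i < c → ¬ P i))
  leastBelow zero = inj₁ (λ i ())
  leastBelow (suc y) with leastBelow y
  ... | inj₂ (c , pc , c<y , below) = inj₂ (c , pc , m<n⇒m<1+n c<y , below)
  ... | inj₁ below with P? y
  ...   | yes py = inj₂ (y , py , <+1 , below)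
  ...   | no ¬py = inj₁ λ i i<1+y → [ (λ i<y → below i i<y) , (λ { refl → ¬py }) ]′ (m<1+n⇒m<n∨m≡n i<1+y)
... | inj₁ below = ⊥-elim (below y <+1 py)
... | inj₂ (c , pc , c<1+y , below) = c , pc , ≤-pred c<1+y , below

injection⇒≤ : ∀ a b (f : ℕ → ℕ) → (∀ {i} → i < a → f i < b) →
              (∀ {i j} → i < a → j < a → f i ≡ f j → i ≡ j) → a ≤ b
injection⇒≤ a b f f<b f-inj = injective⇒≤ {f = f′} f′-inj
  where
  f′ : Fin a → Fin b
  f′ i = fromℕ< (f<b (toℕ<n i))
  f′-inj : ∀ {i j} → f′ i ≡ f′ j → i ≡ j
  f′-inj {i} {j} e = toℕ-injective (f-inj (toℕ<n i) (toℕ<n j)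
    (trans (sym (toℕ-fromℕ< (f<b (toℕ<n i)))) (trans (cong toℕ e) (toℕ-fromℕ< (f<b (toℕ<n j))))))

Occurrence : (ℕ → ℕ) → ℕ → ℕ → ℕ → ℕ → Set
Occurrence s i j k l = (s i < s j × s j < s k × s k < s l) ⊎ (s k < s i × s i < s l × s l < s j)

AvoidsBoth : ℕ → (ℕ → ℕ) → Set
AvoidsBoth n s = ∀ {i j k l} → i < j → j < k → k < l → l < n → Occurrence s i j k l → ⊥

-- A permutation in DA_n(1234,2413) as a function on positions 0 … n−1 with values shifted
-- down by one; alt⁻¹ is the alternation of the inverse: v+1 lies right of v iff v is even.
record DAPerm (n : ℕ) (s : ℕ → ℕ) : Set where
  field
    rng   : ∀ {i} → i < n → s i < n
    inj   : ∀ {i j} → i < n → j < n → s i ≡ s j → i ≡ j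
    sur   : ∀ {v} → v < n → ∃ λ i → i < n × s i ≡ v
    alt   : ∀ {i} → suc i < n → UpDown (even i) (s i) (s (suc i))
    alt⁻¹ : ∀ {i j} → i < n → j < n → s j ≡ suc (s i) → UpDown (even (s i)) i j
    avoid : AvoidsBoth n s

module DA {N : ℕ} {s : ℕ → ℕ} (G : DAPerm N s) where
  open DAPerm G public

  other≢ : ∀ {x y v} → x < N → y < N → x ≢ y → s y ≡ v → s x ≢ v
  other≢ xN yN x≢y refl e = x≢y (inj xN yN e)

  <-at : ∀ {a b x y} → s a ≡ x → s b ≡ y → x < y → s a < s b
  <-at refl refl p = p

  no1234 : ∀ {i j k l} → i < j → j < k → k < l → l < N → s i < s j → s j < s k → s k < s l → ⊥
  no1234 a b c d x y z = avoid a b c d (inj₁ (x , y , z))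

  no2413 : ∀ {i j k l} → i < j → j < k → k < l → l < N → s k < s i → s i < s l → s l < s j → ⊥
  no2413 a b c d x y z = avoid a b c d (inj₂ (x , y , z))

  position : ℕ → ℕ
  position v with v <? N
  ... | yes h = proj₁ (sur h)
  ... | no _ = 0

  position-spec : ∀ {v} → v < N → position v < N × s (position v) ≡ v
  position-spec {v} v<N with v <? N
  ... | yes h = proj₂ (sur h)
  ... | no ¬h = ⊥-elim (¬h v<N)

suffix-count : ∀ {N s} → DAPerm N s → ∀ {c x} → c ≤ N → x ≤ N →
  (∀ {j} → c ≤ j → j < N → s j < x) → (∀ {i} → i < N → s i < x → c ≤ i) → c + x ≡ N
suffix-count {N} {s} G {c} {x} c≤N x≤N suffix-small small-in-suffix =
  trans (cong (c +_) (sym (≤-antisym suffix≤x x≤suffix))) (m+[n∸m]≡n c≤N)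
  where
  open DA G
  idx : ∀ {i} → i < N ∸ c → c + i < N
  idx {i} h = subst (c + i <_) (m+[n∸m]≡n c≤N) (+-monoʳ-< c h)
  suffix≤x : N ∸ c ≤ x
  suffix≤x = injection⇒≤ (N ∸ c) x (λ i → s (c + i))
    (λ {i} h → suffix-small (m≤m+n c i) (idx h))
    (λ {i} {j} hi hj e → +-cancelˡ-≡ c i j (inj (idx hi) (idx hj) e))
  pos : ∀ {v} → v < x → position v < N
  pos h = proj₁ (position-spec (<-≤-trans h x≤N))
  s-pos : ∀ {v} (h : v < x) → s (position v) ≡ v
  s-pos h = proj₂ (position-spec (<-≤-trans h x≤N))
  c≤pos : ∀ {v} → v < x → c ≤ position v
  c≤pos h = small-in-suffix (pos h) (subst (_< x) (sym (s-pos h)) h)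
  x≤suffix : x ≤ N ∸ c
  x≤suffix = injection⇒≤ x (N ∸ c) (λ v → position v ∸ c)
    (λ h → ∸-monoˡ-< (pos h) (c≤pos h))
    (λ hv hw e → trans (sym (s-pos hv)) (trans (cong s (∸-cancelʳ-≡ (c≤pos hv) (c≤pos hw) e)) (s-pos hw)))

data SplitAt (k : ℕ) : ℕ → Set where
  below : ∀ {i} → i < k → SplitAt k i
  above : ∀ i' → SplitAt k (k + i')

splitAt : ∀ k i → SplitAt k i
splitAt zero i = above i
splitAt (suc k) zero = below (s≤s z≤n)
splitAt (suc k) (suc i) with splitAt k i
... | below p = below (s≤s p)
... | above i' = above i'

avoids-transfer : ∀ {n n' s t} (φ : ℕ → ℕ) → (∀ {x y} → x < y → φ x < φ y) → (∀ {x} → x < n' → φ x < n) →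
  (∀ {x y} → x < n' → y < n' → t x < t y → s (φ x) < s (φ y)) → AvoidsBoth n s → AvoidsBoth n' t
avoids-transfer {n} {n'} {s} {t} φ mono bnd rel avoid {i} {j} {k} {l} a b c d bad =
  avoid (mono a) (mono b) (mono c) (bnd d) (tr bad)
  where
  kN = <-trans c d
  jN = <-trans b kN
  iN = <-trans a jN
  tr : Occurrence t i j k l → Occurrence s (φ i) (φ j) (φ k) (φ l)
  tr (inj₁ (x , y , z)) = inj₁ (rel iN jN x , rel jN kN y , rel kN d z)
  tr (inj₂ (x , y , z)) = inj₂ (rel kN iN x , rel iN d y , rel d jN z)

DAPerm-cong : ∀ {n s t} → (∀ i → s i ≡ t i) → DAPerm n s → DAPerm n t
DAPerm-cong {n} {s} {t} e G = record
  { rng = λ {i} h → subst (_< n) (e i) (rng h)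
  ; inj = λ {i} {j} hi hj q → inj hi hj (trans (e i) (trans q (sym (e j))))
  ; sur = λ {v} h → let (i , i<n , si) = sur h in i , i<n , trans (sym (e i)) si
  ; alt = λ {i} h → subst₂ (UpDown (even i)) (e i) (e (suc i)) (alt h)
  ; alt⁻¹ = λ {i} {j} hi hj q → subst (λ z → UpDown (even z) i j) (e i) (alt⁻¹ hi hj (trans (e j) (trans q (cong suc (sym (e i))))))
  ; avoid = avoids-transfer (λ x → x) (λ p → p) (λ p → p) (λ {x} {y} _ _ p → subst₂ _<_ (sym (e x)) (sym (e y)) p) avoid
  }
  where open DAPerm G

drop-prefix : ∀ k n' s → even k ≡ true → DAPerm (k + n') s → (∀ {i} → i < k → n' ≤ s i) →
            (∀ {j} → j < k + n' → n' ≤ s j → j < k) → DAPerm n' (λ i → s (k + i))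
drop-prefix k n' s ek G h1 h2 = record
  { rng = λ {i} h → ≰⇒> (λ le → <-irrefl refl (<-≤-trans (h2 (idx h) le) (m≤m+n k i)))
  ; inj = λ {i} {j} hi hj e → +-cancelˡ-≡ k i j (inj (idx hi) (idx hj) e)
  ; sur = λ {v} h → srf h (sur (<-≤-trans h (m≤n+m n' k)))
  ; alt = λ {i} h → subst (λ z → UpDown z (s (k + i)) (s (k + suc i))) (even-+ k i ek)
           (subst (λ z → UpDown (even (k + i)) (s (k + i)) (s z)) (sym (+-suc k i)) (alt (subst (_< k + n') (+-suc k i) (idx h))))
  ; alt⁻¹ = λ {i} {j} hi hj e → UpDown-cancel k (alt⁻¹ (idx hi) (idx hj) e)
  ; avoid = avoids-transfer (k +_) (+-monoʳ-< k) idx (λ _ _ p → p) avoid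
  }
  where
  open DAPerm G
  idx : ∀ {i} → i < n' → k + i < k + n'
  idx h = +-monoʳ-< k h
  srf : ∀ {v} → v < n' → (∃ λ i → i < k + n' × s i ≡ v) → ∃ λ i → i < n' × s (k + i) ≡ v
  srf {v} v<n (i , i<N , si) with splitAt k i
  ... | below i<k = ⊥-elim (<-irrefl refl (<-≤-trans v<n (subst (n' ≤_) si (h1 i<k))))
  ... | above i' = i' , +-cancelˡ-< k i' n' i<N , si

occurrence-first<last : ∀ {s i j k l} → Occurrence s i j k l → s i < s l
occurrence-first<last (inj₁ (x , y , z)) = <-trans x (<-trans y z)
occurrence-first<last (inj₂ (x , y , z)) = y

occurrence-cancel : ∀ {s β i j k l} c → s i ≡ c + β i → s j ≡ c + β j → s k ≡ c + β k → s l ≡ c + β l →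
             Occurrence s i j k l → Occurrence β i j k l
occurrence-cancel {s} {β} {i} {j} {k} {l} c ei ej ek el b with s i | s j | s k | s l
occurrence-cancel {s} {β} {i} {j} {k} {l} c refl refl refl refl (inj₁ (x , y , z)) | _ | _ | _ | _ =
  inj₁ (+-cancelˡ-< c _ _ x , +-cancelˡ-< c _ _ y , +-cancelˡ-< c _ _ z)
occurrence-cancel {s} {β} {i} {j} {k} {l} c refl refl refl refl (inj₂ (x , y , z)) | _ | _ | _ | _ =
  inj₂ (+-cancelˡ-< c _ _ x , +-cancelˡ-< c _ _ y , +-cancelˡ-< c _ _ z)

prepend-block : ∀ k n' s (β : ℕ → ℕ) → even k ≡ true → even n' ≡ true → DAPerm k β →
         (∀ {i} → i < k → s i ≡ n' + β i) → DAPerm n' (λ i → s (k + i)) → DAPerm (k + n') s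
prepend-block k n' s β ek en' B sb T = record
  { rng = rngF ; inj = injF ; sur = surF ; alt = altF ; alt⁻¹ = alt⁻¹F ; avoid = avoidF }
  where
  module B = DAPerm B
  module T = DAPerm T
  t = λ i → s (k + i)
  lowb : ∀ {i} → i < k → n' ≤ s i
  lowb h = subst (n' ≤_) (sym (sb h)) (m≤m+n n' _)
  tl : ∀ {i'} → k + i' < k + n' → i' < n'
  tl {i'} h = +-cancelˡ-< k i' n' h
  rngF : ∀ {i} → i < k + n' → s i < k + n'
  rngF {i} h with splitAt k i
  ... | below i<k = subst (_< k + n') (sym (sb i<k)) (subst (n' + β i <_) (+-comm n' k) (+-monoʳ-< n' (B.rng i<k)))
  ... | above i' = <-≤-trans (T.rng (tl h)) (m≤n+m n' k)
  injF : ∀ {i j} → i < k + n' → j < k + n' → s i ≡ s j → i ≡ j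
  injF {i} {j} ih jh e with splitAt k i | splitAt k j
  ... | below a | below b = B.inj a b (+-cancelˡ-≡ n' _ _ (trans (sym (sb a)) (trans e (sb b))))
  ... | below a | above j' = ⊥-elim (<-irrefl refl (<-≤-trans (T.rng (tl jh)) (subst (n' ≤_) e (lowb a))))
  ... | above i' | below b = ⊥-elim (<-irrefl refl (<-≤-trans (T.rng (tl ih)) (subst (n' ≤_) (sym e) (lowb b))))
  ... | above i' | above j' = cong (k +_) (T.inj (tl ih) (tl jh) e)
  surF : ∀ {v} → v < k + n' → ∃ λ i → i < k + n' × s i ≡ v
  surF {v} h with splitAt n' v
  ... | below v<n = let (i , i<n , ti) = T.sur v<n in k + i , +-monoʳ-< k i<n , ti
  ... | above w = let (i , i<k , bi) = B.sur (+-cancelˡ-< n' w k (subst (n' + w <_) (+-comm k n') h))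
               in i , <-≤-trans i<k (m≤m+n k n') , trans (sb i<k) (cong (n' +_) bi)
  altF : ∀ {i} → suc i < k + n' → UpDown (even i) (s i) (s (suc i))
  altF {i} h with splitAt k i
  ... | above i' = subst (λ z → UpDown z (s (k + i')) (s (suc (k + i')))) (sym (even-+ k i' ek))
                 (subst (λ z → UpDown (even i') (s (k + i')) (s z)) (+-suc k i')
                   (T.alt (tl (subst (_< k + n') (sym (+-suc k i')) h))))
  ... | below i<k with m≤n⇒m<n∨m≡n i<k
  ...   | inj₁ si<k = subst₂ (UpDown (even i)) (sym (sb (<-trans <+1 si<k))) (sym (sb si<k)) (UpDown-+ n' (B.alt si<k))
  ...   | inj₂ refl = subst (λ z → UpDown z (s i) (s (suc i))) (sym (even-suc⇒odd {i} ek))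
           (<-≤-trans (subst (_< n') (cong s (+-identityʳ (suc i))) (T.rng n'>0)) (lowb i<k))
    where
    n'>0 : 0 < n'
    n'>0 = +-cancelˡ-< (suc i) 0 n' (subst (_< suc i + n') (sym (+-identityʳ (suc i))) h)
  alt⁻¹F : ∀ {i j} → i < k + n' → j < k + n' → s j ≡ suc (s i) → UpDown (even (s i)) i j
  alt⁻¹F {i} {j} ih jh e with splitAt k i | splitAt k j
  ... | below a | below b = subst (λ z → UpDown z i j) (trans (sym (even-+ n' (β i) en')) (cong even (sym (sb a))))
        (B.alt⁻¹ a b (+-cancelˡ-≡ n' _ _ (trans (sym (sb b)) (trans e (trans (cong suc (sb a)) (sym (+-suc n' (β i))))))))
  ... | below a | above j' = ⊥-elim (<-irrefl refl (<-trans (T.rng (tl jh)) (subst (n' <_) (sym e) (s≤s (lowb a)))))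
  ... | above i' | above j' = UpDown-+ k (T.alt⁻¹ (tl ih) (tl jh) e)
  ... | above i' | below b = subst (λ z → UpDown z (k + i') j) (sym evt) (<-≤-trans b (m≤m+n k i'))
    where
    eqn : suc (t i') ≡ n'
    eqn = ≤-antisym (T.rng (tl ih)) (subst (n' ≤_) e (lowb b))
    evt : even (t i') ≡ false
    evt = even-suc⇒odd {t i'} (trans (cong even eqn) en')
  avoidF : ∀ {a b c d} → a < b → b < c → c < d → d < k + n' → Occurrence s a b c d → ⊥
  avoidF {a} {b} {c} {d} ab bc cd dN bad with splitAt k d
  ... | below d<k = B.avoid ab bc cd d<k (occurrence-cancel {s} {β} n' (sb aK) (sb bK) (sb cK) (sb d<k) bad)
    where
    cK = <-trans cd d<k
    bK = <-trans bc cK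
    aK = <-trans ab bK
  ... | above d' with splitAt k a
  ...   | below a<k = <-irrefl refl (<-≤-trans (<-trans (occurrence-first<last {s} bad) (T.rng (tl dN))) (lowb a<k))
  ...   | above a' with splitAt k b | splitAt k c
  ...     | below b<k | _ = <-irrefl refl (≤-<-trans (m≤m+n k a') (<-trans ab b<k))
  ...     | above b' | below c<k = <-irrefl refl (≤-<-trans (m≤m+n k b') (<-trans bc c<k))
  ...     | above b' | above c' = T.avoid (+-cancelˡ-< k a' b' ab) (+-cancelˡ-< k b' c' bc) (+-cancelˡ-< k c' d' cd) (tl dN) bad

-- Away from position 0 the only increasing pairs are the adjacent ones (2i, 2i+1): the invariant
-- by which unpeel keeps both patterns avoided.
AdjacentAscents : ℕ → (ℕ → ℕ) → Set
AdjacentAscents n s = ∀ {x y} → 0 < x → x < y → y < n → s x < s y → even x ≡ true × y ≡ suc x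

adjacentAscents⇒avoids : ∀ {n s} → s 0 ≡ 0 → AdjacentAscents n s → AvoidsBoth n s
adjacentAscents⇒avoids {n} {s} s0 q {i} {j} {k} {l} ij jk kl ln (inj₁ (a , b , c)) with q (≤-trans (s≤s z≤n) ij) jk (<-trans kl ln) b
... | ej , refl with q (<-trans (≤-trans (s≤s z≤n) ij) jk) kl ln c
...   | ek , _ = case trans (sym (even⇒odd-suc {j} ej)) ek of λ ()
adjacentAscents⇒avoids {n} {s} s0 q {zero} {j} {k} {l} ij jk kl ln (inj₂ (a , b , c)) = n≮0 (subst (s k <_) s0 a)
adjacentAscents⇒avoids {n} {s} s0 q {suc i} {j} {k} {l} ij jk kl ln (inj₂ (a , b , c)) with q (s≤s z≤n) (<-trans ij (<-trans jk kl)) ln b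
... | _ , refl = <-irrefl refl (<-≤-trans (<-trans jk kl) (≤-pred (s≤s ij)))

AdjacentAscents-cong : ∀ {n s t} → (∀ i → s i ≡ t i) → AdjacentAscents n s → AdjacentAscents n t
AdjacentAscents-cong {n} {s} {t} e q {x} {y} a b c h = q a b c (subst₂ _<_ (sym (e x)) (sym (e y)) h)

UpDown? : ∀ b x y → Dec (UpDown b x y)
UpDown? true x y = x <? y
UpDown? false x y = y <? x

module Decide (n : ℕ) (s : ℕ → ℕ) where
  rng? : Dec (∀ {i} → i < n → s i < n)
  rng? = allUpTo? (λ i → s i <? n) n
  inj? : Dec (∀ {i} → i < n → ∀ {j} → j < n → s i ≡ s j → i ≡ j)
  inj? = allUpTo? (λ i → allUpTo? (λ j → (s i ≟ s j) →-dec (i ≟ j)) n) n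
  sur? : Dec (∀ {v} → v < n → ∃ λ i → i < n × s i ≡ v)
  sur? = allUpTo? (λ v → anyUpTo? (λ i → s i ≟ v) n) n
  alt? : Dec (∀ {i} → i < n → suc i < n → UpDown (even i) (s i) (s (suc i)))
  alt? = allUpTo? (λ i → (suc i <? n) →-dec UpDown? (even i) (s i) (s (suc i))) n
  alt⁻¹? : Dec (∀ {i} → i < n → ∀ {j} → j < n → s j ≡ suc (s i) → UpDown (even (s i)) i j)
  alt⁻¹? = allUpTo? (λ i → allUpTo? (λ j → (s j ≟ suc (s i)) →-dec UpDown? (even (s i)) i j) n) n
  occurrence? : ∀ i j k l → Dec (Occurrence s i j k l)
  occurrence? i j k l = ((s i <? s j) ×-dec ((s j <? s k) ×-dec (s k <? s l))) ⊎-dec ((s k <? s i) ×-dec ((s i <? s l) ×-dec (s l <? s j)))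
  avoid? : Dec (∀ {l} → l < n → ∀ {k} → k < l → ∀ {j} → j < k → ∀ {i} → i < j → ¬ Occurrence s i j k l)
  avoid? = allUpTo? (λ l → allUpTo? (λ k → allUpTo? (λ j → allUpTo? (λ i → ¬? (occurrence? i j k l)) j) k) l) n
  adjacentAscents? : Dec (∀ {y} → y < n → ∀ {x} → x < y → 0 < x → s x < s y → even x ≡ true × y ≡ suc x)
  adjacentAscents? = allUpTo? (λ y → allUpTo? (λ x → (0 <? x) →-dec ((s x <? s y) →-dec ((even x Bool.≟ true) ×-dec (y ≟ suc x)))) y) n

  fromDecided : True rng? → True inj? → True sur? → True alt? → True alt⁻¹? → True avoid? → DAPerm n s
  fromDecided a b c d e f = record
    { rng = toWitness a
    ; inj = λ hi hj → toWitness b hi hj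
    ; sur = toWitness c
    ; alt = λ h → toWitness d (<-trans <+1 h) h
    ; alt⁻¹ = λ hi hj → toWitness e hi hj
    ; avoid = λ ij jk kl ln → toWitness f ln kl jk ij
    }
  fromDecidedAscents : True adjacentAscents? → AdjacentAscents n s
  fromDecidedAscents a x>0 xy yn = toWitness a yn xy x>0

open Decide

da-empty : DAPerm 0 (nth [])
da-empty = fromDecided 0 _ tt tt tt tt tt tt

da-0 : DAPerm 1 (nth (0 ∷ []))
da-0 = fromDecided 1 _ tt tt tt tt tt tt

da-01 : DAPerm 2 (nth (0 ∷ 1 ∷ []))
da-01 = fromDecided 2 _ tt tt tt tt tt tt

da-021 : DAPerm 3 (nth (0 ∷ 2 ∷ 1 ∷ []))
da-021 = fromDecided 3 _ tt tt tt tt tt tt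

ascents-021 : AdjacentAscents 3 (nth (0 ∷ 2 ∷ 1 ∷ []))
ascents-021 = fromDecidedAscents 3 _ tt

da-0213 : DAPerm 4 (nth (0 ∷ 2 ∷ 1 ∷ 3 ∷ []))
da-0213 = fromDecided 4 _ tt tt tt tt tt tt

da-02143 : DAPerm 5 (nth (0 ∷ 2 ∷ 1 ∷ 4 ∷ 3 ∷ []))
da-02143 = fromDecided 5 _ tt tt tt tt tt tt

-- The two openings m (m+1) ⋯ and (m−2) m (m−1) (m+1) ⋯ of a permutation whose top values are m, m+1.
EvenPrefix : ℕ → (ℕ → ℕ) → Set
EvenPrefix m s = (s 0 ≡ m × s 1 ≡ suc m) ⊎
  (∃ λ m' → m ≡ suc (suc m') × s 0 ≡ m' × s 1 ≡ suc (suc m') × s 2 ≡ suc m' × s 3 ≡ suc (suc (suc m')))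

4<4+m⇒5<4+m : ∀ m₂ → even m₂ ≡ true → 4 < 4 + m₂ → 5 < 4 + m₂
4<4+m⇒5<4+m zero e (s≤s (s≤s (s≤s (s≤s ()))))
4<4+m⇒5<4+m (suc zero) () _
4<4+m⇒5<4+m (suc (suc m₂)) e _ = s≤s (s≤s (s≤s (s≤s (s≤s (s≤s z≤n)))))

module EvenPrefixProof (m₂ : ℕ) (s : ℕ → ℕ) (G : DAPerm (4 + m₂) s) (em : even m₂ ≡ true) where
  open DA G
  m₁ = suc m₂
  m = suc m₁
  N = suc (suc m)

  0<N : 0 < N
  0<N = s≤s z≤n
  1<N : 1 < N
  1<N = s≤s (s≤s z≤n)

  2<3 : 2 < 3
  2<3 = s≤s (s≤s (s≤s z≤n))

  max-at-3 : s 1 ≡ m → s 3 ≡ suc m → 3 < N → EvenPrefix m s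
  max-at-3 s1 s3 3<N with sur {m₁} <+3
  ... | q , q<N , sq = go q q<N sq 1<q
    where
    1<q : 1 < q
    1<q = descent (trans (cong even sq) (even⇒odd-suc {m₂} em)) (alt⁻¹ q<N 1<N (trans s1 (cong suc (sym sq))))
    2<N : 2 < N
    2<N = <-trans 2<3 3<N
    -- s2 < s0 with q ≥ 3 gives 2413 (0,1,2,q)
    c2413 : ∀ q → q < N → s q ≡ m₁ → 2 < q → s 2 < s 0 → ⊥
    c2413 q q<N sq 2<q s2<s0 = no2413 (s≤s z≤n) (s≤s (s≤s z≤n)) 2<q q<N s2<s0
      (<-at refl sq (m<3+n∧≢⇒m<n (rng 0<N) (other≢ 0<N q<N (λ e → <⇒≢ (<-trans (s≤s z≤n) 2<q) e) sq)
         (other≢ 0<N 1<N (λ ()) s1) (other≢ 0<N 3<N (λ ()) s3)))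
      (<-at sq s1 (n<1+n m₁))
    go : ∀ q → q < N → s q ≡ m₁ → 1 < q → EvenPrefix m s
    go zero _ _ ()
    go (suc zero) _ _ (s≤s ())
    go (suc (suc zero)) q<N sq _ with sur {m₂} <+4
    ... | r , r<N , sr with ascent (trans (cong even sr) em) (alt⁻¹ r<N q<N (trans sq (cong suc (sym sr))))
    ...   | s≤s z≤n = inj₂ (m₂ , refl , sr , s1 , sq , s3)
    ...   | s≤s (s≤s z≤n) = ⊥-elim (<⇒≢ <+2 (trans (sym sr) s1))
    go (suc (suc (suc zero))) q<N sq _ = ⊥-elim (<⇒≢ <+2 (trans (sym sq) s3))
    go (suc (suc (suc (suc zero)))) q<N sq _ with <-cmp (s 0) (s 2)
    ... | tri> _ _ s2<s0 = ⊥-elim (c2413 4 q<N sq (s≤s (s≤s (s≤s z≤n))) s2<s0)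
    ... | tri≈ _ e _ = ⊥-elim (<⇒≢ <+2 (inj 0<N 2<N e))
    ... | tri< s0<s2 _ _ = ⊥-elim (n<m⇒m≮1+n (subst (_< s 5) sq (alt {4} 5<N))
          (m<1+n∧m≢n⇒m<n (m<1+n∧m≢n⇒m<n (rng 5<N) (other≢ 5<N 3<N (λ ()) s3)) (other≢ 5<N 1<N (λ ()) s1)))
      where
      5<N : 5 < N
      5<N = 4<4+m⇒5<4+m m₂ em q<N
    go (suc (suc (suc (suc (suc q'))))) q<N sq _ with <-cmp (s 0) (s 2)
    ... | tri> _ _ s2<s0 = ⊥-elim (c2413 _ q<N sq (s≤s (s≤s (s≤s z≤n))) s2<s0)
    ... | tri≈ _ e _ = ⊥-elim (<⇒≢ <+2 (inj 0<N 2<N e))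
    ... | tri< s0<s2 _ _ with <-cmp (s 2) (s 4)
    ...   | tri< s2<s4 _ _ = ⊥-elim (no1234 (s≤s z≤n) (s≤s (s≤s (s≤s z≤n))) (s≤s (s≤s (s≤s (s≤s (s≤s z≤n))))) 5<N
              s0<s2 s2<s4 (alt {4} 5<N))
      where
      5<N : 5 < N
      5<N = ≤-trans (s≤s (s≤s (s≤s (s≤s (s≤s (s≤s z≤n)))))) q<N
    ...   | tri≈ _ e _ = ⊥-elim (<⇒≢ <+2 (inj 2<N (<-trans (s≤s (s≤s (s≤s (s≤s (s≤s z≤n))))) q<N) e))
    ...   | tri> _ _ s4<s2 = ⊥-elim (no2413 2<3 (s≤s (s≤s (s≤s (s≤s z≤n)))) (s≤s (s≤s (s≤s (s≤s (s≤s z≤n))))) q<N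
              s4<s2
              (<-at refl sq (m<2+n∧≢⇒m<n (subst (s 2 <_) s3 (alt {2} 3<N))
                 (other≢ 2<N q<N (λ ()) sq) (other≢ 2<N 1<N (λ ()) s1)))
              (<-at sq s3 <+2))

  max-beyond-3 : s 1 ≡ m → ∀ p' → 4 + p' < N → s (4 + p') ≡ suc m → ⊥
  max-beyond-3 s1 p' p<N sp with <-cmp (s 0) (s 2)
  ... | tri< s0<s2 _ _ = no1234 (s≤s z≤n) 2<3 (s≤s (s≤s (s≤s (s≤s z≤n)))) p<N s0<s2 (alt {2} 3<N)
          (<-at refl sp (m<1+n∧m≢n⇒m<n (rng 3<N) (other≢ 3<N p<N (λ ()) sp)))
    where
    3<N : 3 < N
    3<N = <-trans (s≤s (s≤s (s≤s (s≤s z≤n)))) p<N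
  ... | tri≈ _ e _ = <⇒≢ <+2 (inj 0<N (s≤s (s≤s (s≤s z≤n))) e)
  ... | tri> _ _ s2<s0 with sur {m₁} <+3
  ...   | q , q<N , sq = go q q<N sq 1<q
    where
    1<q : 1 < q
    1<q = descent (trans (cong even sq) (even⇒odd-suc {m₂} em)) (alt⁻¹ q<N 1<N (trans s1 (cong suc (sym sq))))
    go : ∀ q → q < N → s q ≡ m₁ → 1 < q → ⊥
    go zero _ _ ()
    go (suc zero) _ _ (s≤s ())
    go (suc (suc zero)) q<N sq _ = n<m⇒m≮1+n (subst (_< s 0) sq s2<s0)
       (m<1+n∧m≢n⇒m<n (m<1+n∧m≢n⇒m<n (rng 0<N) (other≢ 0<N p<N (λ ()) sp)) (other≢ 0<N 1<N (λ ()) s1))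
    go (suc (suc (suc q'))) q<N sq _ = no2413 (s≤s z≤n) (s≤s (s≤s z≤n)) (s≤s (s≤s (s≤s z≤n))) q<N s2<s0
      (<-at refl sq (m<3+n∧≢⇒m<n (rng 0<N) (other≢ 0<N q<N (λ ()) sq)
         (other≢ 0<N 1<N (λ ()) s1) (other≢ 0<N p<N (λ ()) sp)))
      (<-at sq s1 <+1)

  -- m lies left of m+1. At position ≥ 2 it would complete s 0 < s 1 < m < m+1; at position 0
  -- alternation puts m+1 next to it, and at position 1 only position 3 is left for m+1.
  result : EvenPrefix m s
  result with sur {suc m} <+1 | sur {m} <+2
  ... | p , p<N , sp | a , a<N , sa = go a p a<N p<N sa sp a<p
    where
    a<p : a < p
    a<p = ascent (trans (cong even sa) em) (alt⁻¹ a<N p<N (trans sp (cong suc (sym sa))))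
    go : ∀ a p → a < N → p < N → s a ≡ m → s p ≡ suc m → a < p → EvenPrefix m s
    go zero p a<N p<N sa sp _ = inj₁ (sa , n<m<2+n⇒m≡1+n (subst (_< s 1) sa (alt {0} 1<N)) (rng 1<N))
    go (suc zero) zero _ _ _ _ ()
    go (suc zero) (suc zero) _ _ _ _ (s≤s ())
    go (suc zero) (suc (suc zero)) _ p<N sa sp _ = ⊥-elim (<-asym (alt {1} p<N) (<-at sa sp <+1))
    go (suc zero) (suc (suc (suc zero))) _ p<N sa sp _ = max-at-3 sa sp p<N
    go (suc zero) (suc (suc (suc (suc p')))) _ p<N sa sp _ = ⊥-elim (max-beyond-3 sa p' p<N sp)
    go (suc (suc a')) p a<N p<N sa sp a<p = ⊥-elim (no1234 (s≤s z≤n) (s≤s (s≤s z≤n)) a<p p<N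
        (alt {0} 1<N)
        (<-at refl sa (m<2+n∧≢⇒m<n (rng 1<N) (other≢ 1<N a<N (λ ()) sa) (other≢ 1<N p<N (λ e → <⇒≢ (<-trans (s≤s (s≤s z≤n)) a<p) e) sp)))
        (<-at sa sp <+1))

even-prefix : ∀ m s → DAPerm (suc (suc m)) s → even m ≡ true → EvenPrefix m s
even-prefix zero s G _ = inj₁ (z0 , s1)
  where
  open DAPerm G
  a : s 0 < s 1
  a = alt {0} (s≤s (s≤s z≤n))
  s1 : s 1 ≡ 1
  s1 = n<m<2+n⇒m≡1+n (≤-trans (s≤s z≤n) a) (rng (s≤s (s≤s z≤n)))
  z0 : s 0 ≡ 0
  z0 = n≤0⇒n≡0 (≤-pred (subst (s 0 <_) s1 a))
even-prefix (suc (suc m₂)) s G em = EvenPrefixProof.result m₂ s G em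

block01 : ℕ → List ℕ → List ℕ
block01 k l = k ∷ suc k ∷ l

block0213 : ℕ → List ℕ → List ℕ
block0213 k l = k ∷ (2 + k) ∷ (1 + k) ∷ (3 + k) ∷ l

evenFamily : ℕ → List (List ℕ)
evenFamily zero = [] ∷ []
evenFamily (suc zero) = map (block01 0) ([] ∷ [])
evenFamily (suc (suc j)) = map (block01 (double (suc j))) (evenFamily (suc j)) ++ map (block0213 (double j)) (evenFamily j)

block01-DAPerm : ∀ k L → even k ≡ true → DAPerm k (nth L) → DAPerm (2 + k) (nth (block01 k L))
block01-DAPerm k L ek G = prepend-block 2 k (nth (block01 k L)) (nth (0 ∷ 1 ∷ [])) refl ek da-01 sb G
  where
  sb : ∀ {i} → i < 2 → nth (block01 k L) i ≡ k + nth (0 ∷ 1 ∷ []) i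
  sb {zero} _ = sym (+-identityʳ k)
  sb {suc zero} _ = sym (+-comm k 1)
  sb {suc (suc i)} (s≤s (s≤s ()))

block0213-DAPerm : ∀ k L → even k ≡ true → DAPerm k (nth L) → DAPerm (4 + k) (nth (block0213 k L))
block0213-DAPerm k L ek G = prepend-block 4 k (nth (block0213 k L)) (nth (0 ∷ 2 ∷ 1 ∷ 3 ∷ [])) refl ek da-0213 sb G
  where
  sb : ∀ {i} → i < 4 → nth (block0213 k L) i ≡ k + nth (0 ∷ 2 ∷ 1 ∷ 3 ∷ []) i
  sb {zero} _ = sym (+-identityʳ k)
  sb {suc zero} _ = sym (+-comm k 2)
  sb {suc (suc zero)} _ = sym (+-comm k 1)
  sb {suc (suc (suc zero))} _ = sym (+-comm k 3)
  sb {suc (suc (suc (suc i)))} (s≤s (s≤s (s≤s (s≤s ()))))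

evenFamily-sound : ∀ j {L} → L ∈ evenFamily j → length L ≡ double j × DAPerm (double j) (nth L)
evenFamily-sound zero (here refl) = refl , da-empty
evenFamily-sound (suc zero) (here refl) = refl , da-01
evenFamily-sound (suc (suc j)) {L} m with ∈-++⁻ (map (block01 (double (suc j))) (evenFamily (suc j))) m
... | inj₁ m2 with ∈-map⁻ (block01 (double (suc j))) m2
...   | L' , m' , refl = let (len , G) = evenFamily-sound (suc j) m' in cong (λ z → suc (suc z)) len , block01-DAPerm _ L' (even-double (suc j)) G
evenFamily-sound (suc (suc j)) {L} m | inj₂ m4 with ∈-map⁻ (block0213 (double j)) m4
...   | L' , m' , refl = let (len , G) = evenFamily-sound j m' in cong (λ z → 4 + z) len , block0213-DAPerm _ L' (even-double j) G

block01∈evenFamily : ∀ j {R} → R ∈ evenFamily j → block01 (double j) R ∈ evenFamily (suc j)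
block01∈evenFamily zero m = ∈-map⁺ (block01 0) m
block01∈evenFamily (suc j) m = ∈-++⁺ˡ (∈-map⁺ (block01 (double (suc j))) m)

block0213∈evenFamily : ∀ j {R} → R ∈ evenFamily j → block0213 (double j) R ∈ evenFamily (suc (suc j))
block0213∈evenFamily j m = ∈-++⁺ʳ (map (block01 (double (suc j))) (evenFamily (suc j))) (∈-map⁺ (block0213 (double j)) m)

v≡m+0…3 : ∀ {m v} → m ≤ v → v < 4 + m → v ≡ m ⊎ v ≡ 1 + m ⊎ v ≡ 2 + m ⊎ v ≡ 3 + m
v≡m+0…3 {m} {v} le lt with m≤n⇒m<n∨m≡n le
... | inj₂ e = inj₁ (sym e)
... | inj₁ l1 with m≤n⇒m<n∨m≡n l1
...   | inj₂ e = inj₂ (inj₁ (sym e))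
...   | inj₁ l2 with m≤n⇒m<n∨m≡n l2
...     | inj₂ e = inj₂ (inj₂ (inj₁ (sym e)))
...     | inj₁ l3 = inj₂ (inj₂ (inj₂ (≤-antisym (≤-pred lt) l3)))

drop-block01 : ∀ m R → DAPerm (2 + m) (nth (block01 m R)) → DAPerm m (nth R)
drop-block01 m R G = drop-prefix 2 m (nth (block01 m R)) refl G block-high high⇒block
  where
  open DA G
  block-high : ∀ {i} → i < 2 → m ≤ nth (block01 m R) i
  block-high {zero} _ = ≤-refl
  block-high {suc zero} _ = n≤1+n m
  block-high {suc (suc i)} (s≤s (s≤s ()))
  high⇒block : ∀ {i} → i < 2 + m → m ≤ nth (block01 m R) i → i < 2
  high⇒block {i} h le with m≤n⇒m<n∨m≡n le
  ... | inj₂ e = subst (_< 2) (sym (inj h (s≤s z≤n) (sym e))) (s≤s z≤n)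
  ... | inj₁ l = subst (_< 2) (sym (inj h (s≤s (s≤s z≤n)) (n<m<2+n⇒m≡1+n l (rng h)))) (s≤s (s≤s z≤n))

drop-block0213 : ∀ m R → DAPerm (4 + m) (nth (block0213 m R)) → DAPerm m (nth R)
drop-block0213 m R G = drop-prefix 4 m (nth (block0213 m R)) refl G block-high high⇒block
  where
  open DA G
  block-high : ∀ {i} → i < 4 → m ≤ nth (block0213 m R) i
  block-high {zero} _ = ≤-refl
  block-high {suc zero} _ = m≤n+m m 2
  block-high {suc (suc zero)} _ = m≤n+m m 1
  block-high {suc (suc (suc zero))} _ = m≤n+m m 3
  block-high {suc (suc (suc (suc i)))} (s≤s (s≤s (s≤s (s≤s ()))))
  high⇒block : ∀ {i} → i < 4 + m → m ≤ nth (block0213 m R) i → i < 4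
  high⇒block {i} h le with v≡m+0…3 le (rng h)
  ... | inj₁ e = subst (_< 4) (sym (inj h (s≤s z≤n) e)) (s≤s z≤n)
  ... | inj₂ (inj₁ e) = subst (_< 4) (sym (inj h (s≤s (s≤s (s≤s z≤n))) e)) (s≤s (s≤s (s≤s z≤n)))
  ... | inj₂ (inj₂ (inj₁ e)) = subst (_< 4) (sym (inj h (s≤s (s≤s z≤n)) e)) (s≤s (s≤s z≤n))
  ... | inj₂ (inj₂ (inj₂ e)) = subst (_< 4) (sym (inj h (s≤s (s≤s (s≤s (s≤s z≤n)))) e)) (s≤s (s≤s (s≤s (s≤s z≤n))))

evenFamily-complete : ∀ j L → length L ≡ double j → DAPerm (double j) (nth L) → L ∈ evenFamily j
evenFamily-complete zero [] _ _ = here refl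
evenFamily-complete (suc j) (a ∷ b ∷ R) len G with even-prefix (double j) (nth (a ∷ b ∷ R)) G (even-double j)
... | inj₁ (refl , refl) =
  block01∈evenFamily j (evenFamily-complete j R (suc-injective (suc-injective len)) (drop-block01 _ R G))
... | inj₂ (m , 2+m≡ , refl , refl , e2 , e3) = block0213-case j R len 2+m≡ e2 e3 G
  where
  block0213-case : ∀ j R → length (m ∷ 2 + m ∷ R) ≡ double (suc j) → double j ≡ 2 + m →
    nth R 0 ≡ 1 + m → nth R 1 ≡ 3 + m → DAPerm (double (suc j)) (nth (m ∷ 2 + m ∷ R)) → m ∷ 2 + m ∷ R ∈ evenFamily (suc j)
  block0213-case (suc j′) (_ ∷ _ ∷ R′) len 2+m≡ refl refl G with refl ← suc-injective (suc-injective 2+m≡) =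
    block0213∈evenFamily j′ (evenFamily-complete j′ R′ (suc-injective (suc-injective (suc-injective (suc-injective len))))
      (drop-block0213 _ R′ G))

length-evenFamily : ∀ j → length (evenFamily j) ≡ F j
length-evenFamily zero = refl
length-evenFamily (suc zero) = refl
length-evenFamily (suc (suc j)) = trans (length-++ (map (block01 (double (suc j))) (evenFamily (suc j))))
  (cong₂ _+_ (trans (length-map (block01 (double (suc j))) (evenFamily (suc j))) (length-evenFamily (suc j)))
             (trans (length-map (block0213 (double j)) (evenFamily j)) (length-evenFamily j)))

evenFamily-unique : ∀ j → Unique (evenFamily j)
evenFamily-unique zero = [] ∷ []
evenFamily-unique (suc zero) = [] ∷ []
evenFamily-unique (suc (suc j)) = Unique.++⁺ (Unique.map⁺ (λ e → cong (drop 2) e) (evenFamily-unique (suc j)))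
                                 (Unique.map⁺ (λ e → cong (drop 4) e) (evenFamily-unique j)) disj
  where
  disj : ∀ {v} → ¬ (v ∈ map (block01 (double (suc j))) (evenFamily (suc j)) × v ∈ map (block0213 (double j)) (evenFamily j))
  disj (m1 , m2) with ∈-map⁻ (block01 (double (suc j))) m1 | ∈-map⁻ (block0213 (double j)) m2
  ... | x , _ , e1 | y , _ , e2 = <⇒≢ <+1 (sym (cong (λ l → nth l 1) (trans (sym e1) e2)))

Is02143 : (ℕ → ℕ) → Set
Is02143 s = s 0 ≡ 0 × s 1 ≡ 2 × s 2 ≡ 1 × s 3 ≡ 4 × s 4 ≡ 3

max-penultimate⇒02143 : ∀ s → DAPerm 5 s → s 1 ≡ 2 → s 3 ≡ 4 → s 4 ≡ 3 → Is02143 s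
max-penultimate⇒02143 s G s1 s3 s4 with DA.sur G {0} (s≤s z≤n) | DA.sur G {1} (s≤s (s≤s z≤n))
... | r , r<N , sr | t , t<N , st = fin (low-position (s≤s z≤n) sr r<N) (low-position (s≤s (s≤s z≤n)) st t<N) r<t
  where
  open DA G
  r<t : r < t
  r<t = ascent (cong even sr) (alt⁻¹ r<N t<N (trans st (cong suc (sym sr))))
  low-position : ∀ {i v} → v < 2 → s i ≡ v → i < 5 → i ≡ 0 ⊎ i ≡ 2
  low-position {zero} _ _ _ = inj₁ refl
  low-position {suc zero} v<2 e _ = ⊥-elim (<⇒≢ v<2 (trans (sym e) s1))
  low-position {suc (suc zero)} _ _ _ = inj₂ refl
  low-position {suc (suc (suc zero))} v<2 e _ = ⊥-elim (<⇒≢ (≤-trans v<2 (s≤s (s≤s z≤n))) (trans (sym e) s3))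
  low-position {suc (suc (suc (suc zero)))} v<2 e _ = ⊥-elim (<⇒≢ (≤-trans v<2 (s≤s (s≤s z≤n))) (trans (sym e) s4))
  low-position {suc (suc (suc (suc (suc i))))} _ _ (s≤s (s≤s (s≤s (s≤s (s≤s ())))))
  fin : r ≡ 0 ⊎ r ≡ 2 → t ≡ 0 ⊎ t ≡ 2 → r < t → Is02143 s
  fin (inj₁ refl) (inj₂ refl) _ = sr , s1 , st , s3 , s4
  fin (inj₁ refl) (inj₁ refl) ()
  fin (inj₂ refl) (inj₁ refl) ()
  fin (inj₂ refl) (inj₂ refl) (s≤s (s≤s ()))

long-max-penultimate-impossible : ∀ m₃ s → DAPerm (7 + m₃) s → even m₃ ≡ true →
  s 1 ≡ 4 + m₃ → s (5 + m₃) ≡ 6 + m₃ → s (6 + m₃) ≡ 5 + m₃ → ⊥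
long-max-penultimate-impossible m₃ s G em s1 sp sa with <-cmp (s 0) (s 2)
... | tri< s0<s2 _ _ = no1234 (s≤s z≤n) (s≤s (s≤s (s≤s z≤n))) (s≤s (s≤s (s≤s (s≤s z≤n)))) pN
      s0<s2 (alt {2} 3<N) (<-at refl sp (m<1+n∧m≢n⇒m<n (rng 3<N) (other≢ 3<N pN (λ ()) sp)))
  where
  open DA G
  3<N : 3 < 7 + m₃
  3<N = s≤s (s≤s (s≤s (s≤s z≤n)))
  pN : 5 + m₃ < 7 + m₃
  pN = s≤s (s≤s (s≤s (s≤s (s≤s <+2))))
... | tri≈ _ e _ = <⇒≢ <+2 (DA.inj G (s≤s z≤n) (s≤s (s≤s (s≤s z≤n))) e)
... | tri> _ _ s2<s0 with DA.sur G {3 + m₃} (s≤s (s≤s (s≤s <+4)))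
...   | r , r<N , sr = go r r<N sr 1<r
  where
  open DA G
  1<r : 1 < r
  1<r = descent (trans (cong even sr) (even⇒odd-suc {m₃} em)) (alt⁻¹ r<N (s≤s (s≤s z≤n)) (trans s1 (cong suc (sym sr))))
  pN : 5 + m₃ < 7 + m₃
  pN = s≤s (s≤s (s≤s (s≤s (s≤s <+2))))
  aN : 6 + m₃ < 7 + m₃
  aN = s≤s (s≤s (s≤s (s≤s (s≤s (s≤s <+1)))))
  go : ∀ r → r < 7 + m₃ → s r ≡ 3 + m₃ → 1 < r → ⊥
  go zero _ _ ()
  go (suc zero) _ _ (s≤s ())
  go (suc (suc zero)) r<N sr _ = n<m⇒m≮1+n (subst (_< s 0) sr s2<s0)
     (m<1+n∧m≢n⇒m<n (m<1+n∧m≢n⇒m<n (m<1+n∧m≢n⇒m<n (rng (s≤s z≤n)) (other≢ (s≤s z≤n) pN (λ ()) sp)) (other≢ (s≤s z≤n) aN (λ ()) sa)) (other≢ (s≤s z≤n) (s≤s (s≤s z≤n)) (λ ()) s1))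
  go (suc (suc (suc r'))) r<N sr _ = no2413 (s≤s z≤n) (s≤s (s≤s z≤n)) (s≤s (s≤s (s≤s z≤n))) r<N s2<s0
     (<-at refl sr (m<4+n∧≢⇒m<n (rng (s≤s z≤n)) (other≢ (s≤s z≤n) r<N (λ ()) sr) (other≢ (s≤s z≤n) (s≤s (s≤s z≤n)) (λ ()) s1)
        (other≢ (s≤s z≤n) aN (λ ()) sa) (other≢ (s≤s z≤n) pN (λ ()) sp)))
     (<-at sr s1 <+1)

odd-max-penultimate⇒02143 : ∀ m₂ s → DAPerm (3 + m₂) s → even m₂ ≡ true → s 1 ≡ m₂ → s (suc m₂) ≡ suc (suc m₂) →
           s (suc (suc m₂)) ≡ suc m₂ → 2 ≤ m₂ → m₂ ≡ 2 × Is02143 s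
odd-max-penultimate⇒02143 (suc (suc zero)) s G _ s1 s3 s4 _ = refl , max-penultimate⇒02143 s G s1 s3 s4
odd-max-penultimate⇒02143 (suc (suc (suc (suc m₃)))) s G em s1 sp sa _ = ⊥-elim (long-max-penultimate-impossible m₃ s G em s1 sp sa)

OddSecond : ℕ → (ℕ → ℕ) → Set
OddSecond m₂ s = s 1 ≡ suc (suc m₂) ⊎ (m₂ ≡ 2 × Is02143 s)

-- n−1 lies left of n−2 at an odd position; unless that position is 1, the patterns push n−1 and
-- n−2 to the last two positions, which only 02143 survives.
odd-second-or-02143 : ∀ m₂ s → DAPerm (3 + m₂) s → even m₂ ≡ true → OddSecond m₂ s
odd-second-or-02143 m₂ s G em with DA.sur G {2 + m₂} <+1 | DA.sur G {1 + m₂} <+2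
... | p , p<N , sp | a , a<N , sa = go p p<N sp p<a
  where
  open DA G
  1<N : 1 < 3 + m₂
  1<N = s≤s (s≤s z≤n)
  p<a : p < a
  p<a = descent (trans (cong even sa) (even⇒odd-suc {m₂} em)) (alt⁻¹ a<N p<N (trans sp (cong suc (sym sa))))
  go : ∀ p → p < 3 + m₂ → s p ≡ 2 + m₂ → p < a → OddSecond m₂ s
  go zero p<N sp _ = ⊥-elim (n<m⇒m≮1+n (subst (_< s 1) sp (alt {0} 1<N)) (rng 1<N))
  go (suc zero) p<N sp _ = inj₁ sp
  go (suc (suc zero)) p<N sp _ = ⊥-elim (n<m⇒m≮1+n (subst (_< s 1) sp (alt {1} p<N)) (rng 1<N))
  go (suc (suc (suc p'))) p<N sp p<a = rest
    where
    P = 3 + p'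
    sp<N : suc P < 3 + m₂
    sp<N = ≤-trans (s≤s p<a) a<N
    evpF : even P ≡ false
    evpF with even P in e
    ... | true = ⊥-elim (n<m⇒m≮1+n (subst (_< s (suc P)) sp (ascent e (alt sp<N))) (rng sp<N))
    ... | false = refl
    1<a : 1 < a
    1<a = <-trans (s≤s (s≤s z≤n)) p<a
    rest : OddSecond m₂ s
    rest with m≤n⇒m<n∨m≡n p<a
    ... | inj₁ sp<a with <-cmp (s 1) (s (suc P))
    ...   | tri< h _ _ = ⊥-elim (no1234 (s≤s z≤n) (s≤s (s≤s z≤n)) <+1 (≤-trans (s≤s sp<a) a<N)
              (alt {0} 1<N) h (ascent (odd⇒even-suc {P} evpF) (alt (≤-trans (s≤s sp<a) a<N))))
    ...   | tri≈ _ e _ = ⊥-elim (<⇒≢ (s≤s (s≤s z≤n)) (inj 1<N sp<N e))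
    ...   | tri> _ _ h = ⊥-elim (no2413 (s≤s (s≤s z≤n)) <+1 sp<a a<N h
              (<-at refl sa (m<2+n∧≢⇒m<n (rng 1<N) (other≢ 1<N a<N (<⇒≢ 1<a) sa) (other≢ 1<N p<N (λ ()) sp)))
              (<-at sa sp <+1))
    rest | inj₂ refl = fin aEq
      where
      aEq : suc (suc P) ≡ 3 + m₂
      aEq with m≤n⇒m<n∨m≡n a<N
      ... | inj₂ e = e
      ... | inj₁ sa<N = ⊥-elim (<⇒≢ <+2 (sym (inj {suc (suc P)} {P} sa<N p<N
               (trans (n<m<2+n⇒m≡1+n (subst (_< s (suc (suc P))) sa (ascent (odd⇒even-suc {P} evpF) (alt sa<N))) (rng sa<N)) (sym sp)))))
      fin : suc (suc P) ≡ 3 + m₂ → OddSecond m₂ s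
      fin refl with sur {m₂} <+3
      ... | q , q<N , sq = fq q q<N sq (ascent (trans (cong even sq) em) (alt⁻¹ q<N a<N (trans sa (cong suc (sym sq)))))
        where
        fq : ∀ q → q < 3 + m₂ → s q ≡ m₂ → q < suc P → OddSecond m₂ s
        fq zero q<N sq _ = ⊥-elim (n<m⇒m≮1+n (subst (_< s 1) sq (alt {0} 1<N))
             (m<1+n∧m≢n⇒m<n (m<1+n∧m≢n⇒m<n (rng 1<N) (other≢ 1<N p<N (λ ()) sp)) (other≢ 1<N a<N (λ ()) sa)))
        fq (suc zero) q<N sq _ = inj₂ (odd-max-penultimate⇒02143 (suc (suc p')) s G em sq sp sa (s≤s (s≤s z≤n)))
        fq (suc (suc q')) q<N sq q<a = ⊥-elim (no1234 (s≤s z≤n) (s≤s (s≤s z≤n)) q<P p<N (alt {0} 1<N)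
             (<-at refl sq (m<3+n∧≢⇒m<n (rng 1<N) (other≢ 1<N q<N (λ ()) sq) (other≢ 1<N a<N (λ ()) sa) (other≢ 1<N p<N (λ ()) sp)))
             (<-at sq sp <+2))
          where
          q<P : suc (suc q') < P
          q<P = ≤∧≢⇒< (≤-pred q<a) (λ e → <⇒≢ <+2 (trans (sym sq) (trans (cong s e) sp)))

-- If s 0 = x > 0: an odd x needs x+1 to its left, impossible; an even x splits the rest into
-- the values above x (positions 2 .. c−1, c even) and, to avoid 2413 with s 1 = n−1, the values
-- below x (positions c .. n−1), so n = c + x would be even.
odd-max-second⇒first-0 : ∀ m₂ s → DAPerm (3 + m₂) s → even m₂ ≡ true → s 1 ≡ suc (suc m₂) → s 0 ≡ 0
odd-max-second⇒first-0 m₂ s G em s1 with s 0 in s0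
... | zero = refl
... | suc x' = ⊥-elim (by-parity (even x) refl)
  where
  open DA G
  N = 3 + m₂
  x = suc x'
  0<N : 0 < N
  0<N = s≤s z≤n
  1<N : 1 < N
  1<N = s≤s (s≤s z≤n)
  x<m : x < suc (suc m₂)
  x<m = m<1+n∧m≢n⇒m<n (subst (_< N) s0 (rng 0<N)) (λ e → <⇒≢ (s≤s z≤n) (inj 0<N 1<N (trans s0 (trans e (sym s1)))))
  by-parity : ∀ b → even x ≡ b → ⊥
  by-parity false e with sur {suc x} (s≤s x<m)
  ... | t , t<N , st = n≮0 (descent (trans (cong even s0) e) (alt⁻¹ 0<N t<N (trans st (cong suc (sym s0)))))
  by-parity true x-even with sur {x'} (<-trans <+1 (<-trans x<m <+1))
  ... | y , y<N , sy = by-least-c (least P P? y Py)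
    where
    P : ℕ → Set
    P i = 2 ≤ i × i < N × s i < x
    P? : ∀ i → Dec (P i)
    P? i = (2 ≤? i) ×-dec ((i <? N) ×-dec (s i <? x))
    Py : P y
    Py = 2≤y y y<N sy , y<N , subst (_< x) (sym sy) <+1
      where
      2≤y : ∀ y → y < N → s y ≡ x' → 2 ≤ y
      2≤y zero _ e = ⊥-elim (<⇒≢ <+1 (trans (sym e) s0))
      2≤y (suc zero) _ e = ⊥-elim (<⇒≢ (<-trans <+1 x<m) (trans (sym e) s1))
      2≤y (suc (suc y)) _ _ = s≤s (s≤s z≤n)
    by-least-c : (∃ λ c → P c × c ≤ y × (∀ i → i < c → ¬ P i)) → ⊥
    by-least-c (c , (2≤c , c<N , sc<x) , _ , minimal) =
      case trans (sym x-even) (trans (sym (even-+ c x c-even)) (trans (cong even c+x≡N) (even⇒odd-suc {m₂} em))) of λ ()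
      where
      middle-above : ∀ {i} → 2 ≤ i → i < c → x < s i
      middle-above {i} 2≤i i<c = ≤∧≢⇒< (≮⇒≥ (λ h → minimal i i<c (2≤i , <-trans i<c c<N , h)))
        (λ e → <⇒≢ (≤-trans (s≤s z≤n) 2≤i) (sym (inj (<-trans i<c c<N) 0<N (trans (sym e) (sym s0)))))
      suffix-below : ∀ {j} → c ≤ j → j < N → s j < x
      suffix-below {j} c≤j j<N with m≤n⇒m<n∨m≡n c≤j
      ... | inj₂ refl = sc<x
      ... | inj₁ c<j with <-cmp (s j) x
      ...   | tri< h _ _ = h
      ...   | tri≈ _ e _ = ⊥-elim (<⇒≢ (≤-trans (s≤s z≤n) (≤-trans 2≤c (<⇒≤ c<j))) (sym (inj j<N 0<N (trans e (sym s0)))))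
      ...   | tri> _ _ h = ⊥-elim (no2413 (s≤s z≤n) (≤-trans (s≤s (s≤s z≤n)) 2≤c) c<j j<N
                 (subst (s c <_) (sym s0) sc<x) (subst (_< s j) (sym s0) h)
                 (subst (s j <_) (sym s1) (m<1+n∧m≢n⇒m<n (rng j<N) (other≢ j<N 1<N (λ e → <⇒≢ (≤-trans (s≤s (s≤s z≤n)) (≤-trans 2≤c (<⇒≤ c<j))) (sym e)) s1))))
      below-in-suffix : ∀ {i} → i < N → s i < x → c ≤ i
      below-in-suffix {zero} _ v<x = ⊥-elim (<⇒≢ v<x s0)
      below-in-suffix {suc zero} _ v<x = ⊥-elim (<⇒≢ (<-trans v<x x<m) s1)
      below-in-suffix {suc (suc i)} i<N v<x = ≮⇒≥ (λ h → <-asym v<x (middle-above (s≤s (s≤s z≤n)) h))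
      c-even : even c ≡ true
      c-even = go c 2≤c c<N sc<x middle-above
        where
        go : ∀ c → 2 ≤ c → c < N → s c < x → (∀ {i} → 2 ≤ i → i < c → x < s i) → even c ≡ true
        go (suc zero) (s≤s ()) _ _ _
        go (suc (suc zero)) _ _ _ _ = refl
        go (suc (suc (suc c₁))) _ c<N sc<x middle with even (suc (suc c₁)) in e
        ... | true = ⊥-elim (<-asym (<-trans (ascent e (alt {suc (suc c₁)} c<N)) sc<x) (middle (s≤s (s≤s z≤n)) <+1))
        ... | false = odd⇒even-suc {suc (suc c₁)} e
      c+x≡N : c + x ≡ N
      c+x≡N = suffix-count G (<⇒≤ c<N) (<⇒≤ (<-trans x<m <+1)) suffix-below below-in-suffix

odd-no-max-3-at-4 : ∀ m₃ s → DAPerm (5 + m₃) s → s 0 ≡ 0 → s 1 ≡ 4 + m₃ → s 3 ≡ 3 + m₃ → s 4 ≡ 2 + m₃ → ⊥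
odd-no-max-3-at-4 zero s G s0 s1 s3 s4 = n≮0 (≤-pred (≤-pred (descent (cong even s2) (alt⁻¹ (s≤s (s≤s (s≤s z≤n))) (s≤s (s≤s (s≤s (s≤s (s≤s z≤n))))) (trans s4 (cong suc (sym s2)))))))
  where
  open DA G
  s2<2 : s 2 < 2
  s2<2 = m<1+n∧m≢n⇒m<n (subst (s 2 <_) s3 (alt {2} (s≤s (s≤s (s≤s (s≤s z≤n)))))) (other≢ (s≤s (s≤s (s≤s z≤n))) (s≤s (s≤s (s≤s (s≤s (s≤s z≤n))))) (λ ()) s4)
  s2 : s 2 ≡ 1
  s2 = n<m<2+n⇒m≡1+n (n≢0⇒n>0 (other≢ (s≤s (s≤s (s≤s z≤n))) (s≤s z≤n) (λ ()) s0)) s2<2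
odd-no-max-3-at-4 (suc m₄) s G s0 s1 s3 s4 = n<m⇒m≮1+n (subst (_< s 5) s4 (alt {4} 5<N))
   (m<1+n∧m≢n⇒m<n (m<1+n∧m≢n⇒m<n (rng 5<N) (other≢ 5<N (s≤s (s≤s z≤n)) (λ ()) s1)) (other≢ 5<N (s≤s (s≤s (s≤s (s≤s z≤n)))) (λ ()) s3))
  where
  open DA G
  5<N : 5 < 5 + suc m₄
  5<N = s≤s (s≤s (s≤s (s≤s (s≤s (s≤s z≤n)))))

odd-third-fourth : ∀ m₃ s → DAPerm (5 + m₃) s → even m₃ ≡ true → s 0 ≡ 0 → s 1 ≡ 4 + m₃ → s 2 ≡ 2 + m₃ × s 3 ≡ 3 + m₃
odd-third-fourth m₃ s G em s0 s1 with DA.sur G {3 + m₃} (s≤s (s≤s (s≤s (s≤s (<⇒≤ <+1)))))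
... | a , a<N , sa = with-n−2-at-3 (position-of-n−2 a a<N sa)
  where
  open DA G
  N = 5 + m₃
  0<N : 0 < N
  0<N = s≤s z≤n
  1<N : 1 < N
  1<N = s≤s (s≤s z≤n)
  2<N : 2 < N
  2<N = s≤s (s≤s (s≤s z≤n))
  3<N : 3 < N
  3<N = s≤s (s≤s (s≤s (s≤s z≤n)))
  4<N : 4 < N
  4<N = s≤s (s≤s (s≤s (s≤s (s≤s z≤n))))
  0<s2 : 0 < s 2
  0<s2 = n≢0⇒n>0 (other≢ 2<N 0<N (λ ()) s0)
  s0<s2 : s 0 < s 2
  s0<s2 = subst (_< s 2) (sym s0) 0<s2
  position-of-n−2 : ∀ a → a < N → s a ≡ 3 + m₃ → s 3 ≡ 3 + m₃
  position-of-n−2 zero _ sa with trans (sym sa) s0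
  ... | ()
  position-of-n−2 (suc zero) _ sa = ⊥-elim (<⇒≢ <+1 (trans (sym sa) s1))
  position-of-n−2 (suc (suc zero)) _ sa = ⊥-elim (<⇒≢ (s≤s (s≤s z≤n)) (sym (inj {3} {1} 3<N 1<N
        (trans (n<m<2+n⇒m≡1+n (subst (_< s 3) sa (alt {2} 3<N)) (rng 3<N)) (sym s1)))))
  position-of-n−2 (suc (suc (suc zero))) _ sa = sa
  position-of-n−2 (suc (suc (suc (suc a')))) a<N sa with <-cmp (s 3) (s (4 + a'))
  ... | tri< h _ _ = ⊥-elim (no1234 (s≤s z≤n) (s≤s (s≤s (s≤s z≤n))) (s≤s (s≤s (s≤s (s≤s z≤n)))) a<N s0<s2 (alt {2} 3<N) h)
  ... | tri≈ _ e _ = ⊥-elim (<⇒≢ (s≤s (s≤s (s≤s (s≤s z≤n)))) (inj 3<N a<N e))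
  ... | tri> _ _ h = ⊥-elim (n<m⇒m≮1+n (subst (_< s 3) sa h) (m<1+n∧m≢n⇒m<n (rng 3<N) (other≢ 3<N 1<N (λ ()) s1)))
  with-n−2-at-3 : s 3 ≡ 3 + m₃ → s 2 ≡ 2 + m₃ × s 3 ≡ 3 + m₃
  with-n−2-at-3 s3 with sur {2 + m₃} (s≤s (s≤s (s≤s (<⇒≤ <+2))))
  ... | c , c<N , sc = position-of-n−3 c c<N sc , s3
    where
    position-of-n−3 : ∀ c → c < N → s c ≡ 2 + m₃ → s 2 ≡ 2 + m₃
    position-of-n−3 zero _ sc with trans (sym sc) s0
    ... | ()
    position-of-n−3 (suc zero) _ sc = ⊥-elim (<⇒≢ <+2 (trans (sym sc) s1))
    position-of-n−3 (suc (suc zero)) _ sc = sc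
    position-of-n−3 (suc (suc (suc zero))) _ sc = ⊥-elim (<⇒≢ <+1 (trans (sym sc) s3))
    position-of-n−3 (suc (suc (suc (suc zero)))) _ sc = ⊥-elim (odd-no-max-3-at-4 m₃ s G s0 s1 s3 sc)
    position-of-n−3 (suc (suc (suc (suc (suc c'))))) c<N sc with <-cmp (s 2) (s 4)
    ... | tri< h _ _ = ⊥-elim (no1234 (s≤s z≤n) (s≤s (s≤s (s≤s z≤n))) (s≤s (s≤s (s≤s (s≤s (s≤s z≤n))))) 5<N s0<s2 h (alt {4} 5<N))
      where
      5<N : 5 < N
      5<N = ≤-trans (s≤s (s≤s (s≤s (s≤s (s≤s (s≤s z≤n)))))) c<N
    ... | tri≈ _ e _ = ⊥-elim (<⇒≢ (s≤s (s≤s (s≤s z≤n))) (inj 2<N 4<N e))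
    ... | tri> _ _ h = ⊥-elim (no2413 (s≤s (s≤s (s≤s z≤n))) (s≤s (s≤s (s≤s (s≤s z≤n)))) (s≤s (s≤s (s≤s (s≤s (s≤s z≤n))))) c<N h
          (<-at refl sc (m<1+n∧m≢n⇒m<n (subst (s 2 <_) s3 (alt {2} 3<N)) (other≢ 2<N c<N (λ ()) sc)))
          (<-at sc s3 <+1))

-- peel deletes n−1 and n−2 from 0 (n−1) (n−3) (n−2) ⋯ and unpeel inserts them again.
peel : ℕ → (ℕ → ℕ) → ℕ → ℕ
peel m₃ s zero = 0
peel m₃ s (suc zero) = 2 + m₃
peel m₃ s (suc (suc i)) = s (4 + i)

peel-positions : ℕ → ℕ
peel-positions zero = 0
peel-positions (suc zero) = 1
peel-positions (suc (suc i)) = 4 + i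

odd-peel : ∀ m₃ s → DAPerm (5 + m₃) s → even m₃ ≡ true → s 0 ≡ 0 → s 1 ≡ 4 + m₃ → s 2 ≡ 2 + m₃ → s 3 ≡ 3 + m₃ →
          DAPerm (3 + m₃) (peel m₃ s)
odd-peel m₃ s G em s0 s1 s2 s3 = record
  { rng = rngF ; inj = injF ; sur = surF ; alt = altF ; alt⁻¹ = alt⁻¹F
  ; avoid = avoids-transfer peel-positions mono bnd rel avoid }
  where
  open DA G
  N = 5 + m₃
  t = peel m₃ s
  0<N : 0 < N
  0<N = s≤s z≤n
  1<N : 1 < N
  1<N = s≤s (s≤s z≤n)
  2<N : 2 < N
  2<N = s≤s (s≤s (s≤s z≤n))
  3<N : 3 < N
  3<N = s≤s (s≤s (s≤s (s≤s z≤n)))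
  up : ∀ {i} → suc (suc i) < 3 + m₃ → 4 + i < N
  up h = s≤s (s≤s h)
  mid0 : ∀ {i} → 4 + i < N → 0 < s (4 + i)
  mid0 h = n≢0⇒n>0 (other≢ h 0<N (λ ()) s0)
  midT : ∀ {i} → 4 + i < N → s (4 + i) < 2 + m₃
  midT h = m<1+n∧m≢n⇒m<n (m<1+n∧m≢n⇒m<n (m<1+n∧m≢n⇒m<n (rng h) (other≢ h 1<N (λ ()) s1)) (other≢ h 3<N (λ ()) s3)) (other≢ h 2<N (λ ()) s2)
  rngF : ∀ {i} → i < 3 + m₃ → t i < 3 + m₃
  rngF {zero} _ = s≤s z≤n
  rngF {suc zero} _ = <+1
  rngF {suc (suc i)} h = <-trans (midT (up h)) <+1
  injF : ∀ {i j} → i < 3 + m₃ → j < 3 + m₃ → t i ≡ t j → i ≡ j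
  injF {zero} {zero} _ _ _ = refl
  injF {zero} {suc (suc j)} _ hj e = ⊥-elim (<⇒≢ (mid0 (up hj)) e)
  injF {suc zero} {suc zero} _ _ _ = refl
  injF {suc zero} {suc (suc j)} _ hj e = ⊥-elim (<⇒≢ (midT (up hj)) (sym e))
  injF {suc (suc i)} {zero} hi _ e = ⊥-elim (<⇒≢ (mid0 (up hi)) (sym e))
  injF {suc (suc i)} {suc zero} hi _ e = ⊥-elim (<⇒≢ (midT (up hi)) e)
  injF {suc (suc i)} {suc (suc j)} hi hj e = cong pred (cong pred (inj (up hi) (up hj) e))
  surF : ∀ {v} → v < 3 + m₃ → ∃ λ i → i < 3 + m₃ × t i ≡ v
  surF {zero} _ = 0 , s≤s z≤n , refl
  surF {suc v'} h with suc v' ≟ 2 + m₃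
  ... | yes e = 1 , s≤s (s≤s z≤n) , sym e
  ... | no ne' with sur {suc v'} (<-trans h <+2)
  ...   | j , j<N , sj = fj j j<N sj
    where
    v<m : suc v' < 2 + m₃
    v<m = m<1+n∧m≢n⇒m<n h ne'
    fj : ∀ j → j < N → s j ≡ suc v' → ∃ λ i → i < 3 + m₃ × t i ≡ suc v'
    fj zero _ e with trans (sym e) s0
    ... | ()
    fj (suc zero) _ e = ⊥-elim (<⇒≢ (<-trans v<m <+2) (trans (sym e) s1))
    fj (suc (suc zero)) _ e = ⊥-elim (<⇒≢ v<m (trans (sym e) s2))
    fj (suc (suc (suc zero))) _ e = ⊥-elim (<⇒≢ (<-trans v<m <+1) (trans (sym e) s3))
    fj (suc (suc (suc (suc j')))) j<N e = suc (suc j') , ≤-pred (≤-pred j<N) , e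
  altF : ∀ {i} → suc i < 3 + m₃ → UpDown (even i) (t i) (t (suc i))
  altF {zero} _ = s≤s z≤n
  altF {suc zero} h = midT {0} (s≤s (s≤s h))
  altF {suc (suc i)} h = alt (s≤s (s≤s h))
  alt⁻¹F : ∀ {i j} → i < 3 + m₃ → j < 3 + m₃ → t j ≡ suc (t i) → UpDown (even (t i)) i j
  alt⁻¹F {zero} {suc j} _ _ _ = s≤s z≤n
  alt⁻¹F {suc zero} {suc zero} _ _ e = ⊥-elim (<⇒≢ <+1 e)
  alt⁻¹F {suc zero} {suc (suc j)} _ hj e = ⊥-elim (<⇒≢ (<-trans (midT (up hj)) <+1) e)
  alt⁻¹F {suc (suc i)} {suc zero} hi _ e = subst (λ z → UpDown z (suc (suc i)) 1) (sym evt) (s≤s (s≤s z≤n))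
    where
    evt : even (s (4 + i)) ≡ false
    evt = trans (cong even (suc-injective (sym e))) (even⇒odd-suc {m₃} em)
  alt⁻¹F {suc (suc i)} {suc (suc j)} hi hj e = ord-c (alt⁻¹ (up hi) (up hj) e)
    where
    ord-c : ∀ {b} → UpDown b (4 + i) (4 + j) → UpDown b (2 + i) (2 + j)
    ord-c {true} o = ≤-pred (≤-pred o)
    ord-c {false} o = ≤-pred (≤-pred o)
  mono : ∀ {x y} → x < y → peel-positions x < peel-positions y
  mono {zero} {suc zero} _ = s≤s z≤n
  mono {zero} {suc (suc y)} _ = s≤s z≤n
  mono {suc zero} {suc (suc y)} _ = s≤s (s≤s z≤n)
  mono {suc zero} {suc zero} (s≤s ())
  mono {suc (suc x)} {suc (suc y)} (s≤s (s≤s h)) = s≤s (s≤s (s≤s (s≤s h)))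
  mono {suc (suc x)} {suc zero} (s≤s ())
  bnd : ∀ {x} → x < 3 + m₃ → peel-positions x < N
  bnd {zero} _ = 0<N
  bnd {suc zero} _ = 1<N
  bnd {suc (suc x)} h = up h
  rel : ∀ {x y} → x < 3 + m₃ → y < 3 + m₃ → t x < t y → s (peel-positions x) < s (peel-positions y)
  rel {zero} {suc zero} _ _ _ = <-at s0 s1 (s≤s z≤n)
  rel {zero} {suc (suc y)} _ hy _ = subst (_< s (4 + y)) (sym s0) (mid0 (up hy))
  rel {suc zero} {suc zero} _ _ h = ⊥-elim (<-irrefl refl h)
  rel {suc zero} {suc (suc y)} _ hy h = ⊥-elim (<-asym h (midT (up hy)))
  rel {suc (suc x)} {suc zero} hx _ _ = subst (s (4 + x) <_) (sym s1) (<-trans (midT (up hx)) <+2)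
  rel {suc (suc x)} {suc (suc y)} _ _ h = h

unpeel : ℕ → (ℕ → ℕ) → ℕ → ℕ
unpeel m₃ t zero = 0
unpeel m₃ t (suc zero) = 4 + m₃
unpeel m₃ t (suc (suc zero)) = 2 + m₃
unpeel m₃ t (suc (suc (suc zero))) = 3 + m₃
unpeel m₃ t (suc (suc (suc (suc i)))) = t (2 + i)

module Unpeel (m₃ : ℕ) (t : ℕ → ℕ) (T : DAPerm (3 + m₃) t) (em : even m₃ ≡ true) (t0 : t 0 ≡ 0) (t1 : t 1 ≡ 2 + m₃) where
  open DA T
  s = unpeel m₃ t
  N = 5 + m₃
  dn : ∀ {i} → 4 + i < N → 2 + i < 3 + m₃
  dn h = ≤-pred (≤-pred h)
  mid0 : ∀ {i} → 2 + i < 3 + m₃ → 0 < t (2 + i)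
  mid0 h = n≢0⇒n>0 (other≢ h (s≤s z≤n) (λ ()) t0)
  midT : ∀ {i} → 2 + i < 3 + m₃ → t (2 + i) < 2 + m₃
  midT h = m<1+n∧m≢n⇒m<n (rng h) (other≢ h (s≤s (s≤s z≤n)) (λ ()) t1)
  m0 : ∀ {i} → 4 + i < N → 0 < s (4 + i)
  m0 h = mid0 (dn h)
  mT : ∀ {i} → 4 + i < N → s (4 + i) < 2 + m₃
  mT h = midT (dn h)

  rngF : ∀ {i} → i < N → s i < N
  rngF {zero} _ = s≤s z≤n
  rngF {suc zero} _ = <+1
  rngF {suc (suc zero)} _ = <+3
  rngF {suc (suc (suc zero))} _ = <+2
  rngF {suc (suc (suc (suc i)))} h = <-trans (mT h) <+3

  injF : ∀ {i j} → i < N → j < N → s i ≡ s j → i ≡ j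
  injF {zero} {zero} _ _ _ = refl
  injF {suc zero} {suc zero} _ _ _ = refl
  injF {suc zero} {suc (suc zero)} _ _ e = ⊥-elim (<⇒≢ <+2 (sym e))
  injF {suc zero} {suc (suc (suc zero))} _ _ e = ⊥-elim (<⇒≢ <+1 (sym e))
  injF {suc (suc zero)} {suc zero} _ _ e = ⊥-elim (<⇒≢ <+2 e)
  injF {suc (suc zero)} {suc (suc zero)} _ _ _ = refl
  injF {suc (suc zero)} {suc (suc (suc zero))} _ _ e = ⊥-elim (<⇒≢ <+1 e)
  injF {suc (suc (suc zero))} {suc zero} _ _ e = ⊥-elim (<⇒≢ <+1 e)
  injF {suc (suc (suc zero))} {suc (suc zero)} _ _ e = ⊥-elim (<⇒≢ <+1 (sym e))
  injF {suc (suc (suc zero))} {suc (suc (suc zero))} _ _ _ = refl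
  injF {zero} {suc (suc (suc (suc j)))} _ hj e = ⊥-elim (<⇒≢ (m0 hj) e)
  injF {suc zero} {suc (suc (suc (suc j)))} _ hj e = ⊥-elim (<⇒≢ (<-trans (mT hj) <+2) (sym e))
  injF {suc (suc zero)} {suc (suc (suc (suc j)))} _ hj e = ⊥-elim (<⇒≢ (mT hj) (sym e))
  injF {suc (suc (suc zero))} {suc (suc (suc (suc j)))} _ hj e = ⊥-elim (<⇒≢ (<-trans (mT hj) <+1) (sym e))
  injF {suc (suc (suc (suc i)))} {zero} hi _ e = ⊥-elim (<⇒≢ (m0 hi) (sym e))
  injF {suc (suc (suc (suc i)))} {suc zero} hi _ e = ⊥-elim (<⇒≢ (<-trans (mT hi) <+2) e)
  injF {suc (suc (suc (suc i)))} {suc (suc zero)} hi _ e = ⊥-elim (<⇒≢ (mT hi) e)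
  injF {suc (suc (suc (suc i)))} {suc (suc (suc zero))} hi _ e = ⊥-elim (<⇒≢ (<-trans (mT hi) <+1) e)
  injF {suc (suc (suc (suc i)))} {suc (suc (suc (suc j)))} hi hj e = cong (λ z → 2 + z) (inj (dn hi) (dn hj) e)

  surF : ∀ {v} → v < N → ∃ λ i → i < N × s i ≡ v
  surF {zero} _ = 0 , s≤s z≤n , refl
  surF {suc v'} h with <-cmp (suc v') (2 + m₃)
  ... | tri≈ _ e _ = 2 , s≤s (s≤s (s≤s z≤n)) , sym e
  ... | tri> _ _ g with suc v' ≟ 4 + m₃
  ...   | yes e = 1 , s≤s (s≤s z≤n) , sym e
  ...   | no ne' = 3 , s≤s (s≤s (s≤s (s≤s z≤n))) , sym (n<m<2+n⇒m≡1+n g (m<1+n∧m≢n⇒m<n h ne'))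
  surF {suc v'} h | tri< g _ _ with sur {suc v'} (<-trans g <+1)
  ... | j , j<n , tj = fj j j<n tj
    where
    fj : ∀ j → j < 3 + m₃ → t j ≡ suc v' → ∃ λ i → i < N × s i ≡ suc v'
    fj zero _ e with trans (sym e) t0
    ... | ()
    fj (suc zero) _ e = ⊥-elim (<⇒≢ g (trans (sym e) t1))
    fj (suc (suc j')) j<n e = 4 + j' , s≤s (s≤s j<n) , e

  altF : ∀ {i} → suc i < N → UpDown (even i) (s i) (s (suc i))
  altF {zero} _ = s≤s z≤n
  altF {suc zero} _ = <+2
  altF {suc (suc zero)} _ = <+1
  altF {suc (suc (suc zero))} h = <-trans (mT h) <+1
  altF {suc (suc (suc (suc i)))} h = alt (dn h)

  alt⁻¹F : ∀ {i j} → i < N → j < N → s j ≡ suc (s i) → UpDown (even (s i)) i j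
  alt⁻¹F {zero} {suc j} _ _ _ = s≤s z≤n
  alt⁻¹F {suc zero} {j} _ hj e = ⊥-elim (<-irrefl refl (<-≤-trans (rngF hj) (≤-reflexive (sym e))))
  alt⁻¹F {suc (suc zero)} {suc zero} _ _ e = ⊥-elim (<⇒≢ <+1 (sym e))
  alt⁻¹F {suc (suc zero)} {suc (suc zero)} _ _ e = ⊥-elim (<⇒≢ <+1 e)
  alt⁻¹F {suc (suc zero)} {suc (suc (suc j))} _ _ _ = subst (λ z → UpDown z 2 (3 + j)) (sym em) (s≤s (s≤s (s≤s z≤n)))
  alt⁻¹F {suc (suc (suc zero))} {j} _ hj e = subst (λ z → UpDown z 3 j) (sym (even⇒odd-suc {m₃} em)) (g j hj e)
    where
    g : ∀ j → j < N → s j ≡ 4 + m₃ → j < 3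
    g (suc zero) _ _ = s≤s (s≤s z≤n)
    g (suc (suc zero)) _ _ = s≤s (s≤s (s≤s z≤n))
    g (suc (suc (suc zero))) _ e = ⊥-elim (<⇒≢ <+1 e)
    g (suc (suc (suc (suc j)))) hj e = ⊥-elim (<⇒≢ (<-trans (mT hj) <+2) e)
  alt⁻¹F {suc (suc (suc (suc i)))} {suc zero} hi _ e = ⊥-elim (<⇒≢ (<-trans (mT hi) <+1) (suc-injective (sym e)))
  alt⁻¹F {suc (suc (suc (suc i)))} {suc (suc zero)} hi _ e =
    subst (λ z → UpDown z (4 + i) 2) (sym (trans (cong even (suc-injective (sym e))) (even⇒odd-suc {m₃} em))) (s≤s (s≤s (s≤s z≤n)))
  alt⁻¹F {suc (suc (suc (suc i)))} {suc (suc (suc zero))} hi _ e = ⊥-elim (<⇒≢ (mT hi) (suc-injective (sym e)))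
  alt⁻¹F {suc (suc (suc (suc i)))} {suc (suc (suc (suc j)))} hi hj e = ord-a (alt⁻¹ (dn hi) (dn hj) e)
    where
    ord-a : ∀ {b} → UpDown b (2 + i) (2 + j) → UpDown b (4 + i) (4 + j)
    ord-a {true} o = s≤s (s≤s o)
    ord-a {false} o = s≤s (s≤s o)

  ascentsF : AdjacentAscents (3 + m₃) t → AdjacentAscents N s
  ascentsF q {suc zero} {y} _ _ yN h = ⊥-elim (<-irrefl refl (<-≤-trans (rngF yN) h))
  ascentsF q {suc (suc zero)} {suc (suc (suc zero))} _ _ _ _ = refl , refl
  ascentsF q {suc (suc zero)} {suc (suc (suc (suc y)))} _ _ yN h = ⊥-elim (<-asym h (mT yN))
  ascentsF q {suc (suc zero)} {zero} _ () _ _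
  ascentsF q {suc (suc zero)} {suc zero} _ (s≤s ()) _ _
  ascentsF q {suc (suc zero)} {suc (suc zero)} _ (s≤s (s≤s ())) _ _
  ascentsF q {suc (suc (suc zero))} {suc (suc (suc (suc y)))} _ _ yN h = ⊥-elim (<-asym h (<-trans (mT yN) <+1))
  ascentsF q {suc (suc (suc zero))} {zero} _ () _ _
  ascentsF q {suc (suc (suc zero))} {suc zero} _ (s≤s ()) _ _
  ascentsF q {suc (suc (suc zero))} {suc (suc zero)} _ (s≤s (s≤s ())) _ _
  ascentsF q {suc (suc (suc zero))} {suc (suc (suc zero))} _ (s≤s (s≤s (s≤s ()))) _ _
  ascentsF q {suc (suc (suc (suc x)))} {suc (suc (suc (suc y)))} _ (s≤s (s≤s (s≤s (s≤s xy)))) yN h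
    with q (s≤s z≤n) (s≤s (s≤s xy)) (dn yN) h
  ... | ex , e = ex , cong (λ z → 2 + z) e

  unpeel-DAPerm : AdjacentAscents (3 + m₃) t → DAPerm N s × AdjacentAscents N s
  unpeel-DAPerm q = record { rng = rngF ; inj = injF ; sur = surF ; alt = altF ; alt⁻¹ = alt⁻¹F ; avoid = adjacentAscents⇒avoids refl (ascentsF q) } , ascentsF q

oddDA : ℕ → List ℕ
oddDA zero = 0 ∷ []
oddDA (suc zero) = 0 ∷ 2 ∷ 1 ∷ []
oddDA (suc (suc k)) = 0 ∷ (4 + double k) ∷ (2 + double k) ∷ (3 + double k) ∷ drop 2 (oddDA (suc k))

p02143 : List ℕ
p02143 = 0 ∷ 2 ∷ 1 ∷ 4 ∷ 3 ∷ []

oddFamily : ℕ → List (List ℕ)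
oddFamily zero = oddDA 0 ∷ []
oddFamily (suc zero) = oddDA 1 ∷ []
oddFamily (suc (suc zero)) = oddDA 2 ∷ p02143 ∷ []
oddFamily (suc (suc (suc k))) = oddDA (3 + k) ∷ []

oddDA-shape : ∀ k → oddDA (suc k) ≡ 0 ∷ (2 + double k) ∷ drop 2 (oddDA (suc k))
oddDA-shape zero = refl
oddDA-shape (suc k) = refl

nth-drop-2 : ∀ L i → nth (drop 2 L) i ≡ nth L (2 + i)
nth-drop-2 [] i = refl
nth-drop-2 (x ∷ []) i = refl
nth-drop-2 (x ∷ y ∷ L) i = refl

length-oddDA : ∀ k → length (oddDA k) ≡ suc (double k)
length-oddDA zero = refl
length-oddDA (suc zero) = refl
length-oddDA (suc (suc k)) = cong (λ z → 4 + z) (trans (length-drop 2 (oddDA (suc k))) (cong (_∸ 2) (length-oddDA (suc k))))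

oddDA-sound : ∀ k → DAPerm (suc (double k)) (nth (oddDA k)) × AdjacentAscents (suc (double k)) (nth (oddDA k))
oddDA-sound zero = da-0 , Decide.fromDecidedAscents 1 _ tt
oddDA-sound (suc zero) = da-021 , ascents-021
oddDA-sound (suc (suc k)) with oddDA-sound (suc k)
... | T , q with Unpeel.unpeel-DAPerm (double k) (nth (oddDA (suc k))) T (even-double k)
                  (cong (λ l → nth l 0) (oddDA-shape k)) (cong (λ l → nth l 1) (oddDA-shape k)) q
...   | G , q' = DAPerm-cong pointwise G , AdjacentAscents-cong pointwise q'
  where
  pointwise : ∀ i → unpeel (double k) (nth (oddDA (suc k))) i ≡ nth (oddDA (suc (suc k))) i
  pointwise zero = refl
  pointwise (suc zero) = refl
  pointwise (suc (suc zero)) = refl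
  pointwise (suc (suc (suc zero))) = refl
  pointwise (suc (suc (suc (suc i)))) = sym (nth-drop-2 (oddDA (suc k)) i)

oddFamily-sound : ∀ k {L} → L ∈ oddFamily k → length L ≡ suc (double k) × DAPerm (suc (double k)) (nth L)
oddFamily-sound zero (here refl) = refl , proj₁ (oddDA-sound 0)
oddFamily-sound (suc zero) (here refl) = refl , proj₁ (oddDA-sound 1)
oddFamily-sound (suc (suc zero)) (here refl) = length-oddDA 2 , proj₁ (oddDA-sound 2)
oddFamily-sound (suc (suc zero)) (there (here refl)) = refl , da-02143
oddFamily-sound (suc (suc (suc k))) (here refl) = length-oddDA (3 + k) , proj₁ (oddDA-sound (3 + k))

oddDA∈oddFamily : ∀ k → oddDA k ∈ oddFamily k
oddDA∈oddFamily zero = here refl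
oddDA∈oddFamily (suc zero) = here refl
oddDA∈oddFamily (suc (suc zero)) = here refl
oddDA∈oddFamily (suc (suc (suc k))) = here refl

oddFamily-members : ∀ k {L} → L ∈ oddFamily k → L ≡ oddDA k ⊎ (k ≡ 2 × L ≡ p02143)
oddFamily-members zero (here refl) = inj₁ refl
oddFamily-members (suc zero) (here refl) = inj₁ refl
oddFamily-members (suc (suc zero)) (here refl) = inj₁ refl
oddFamily-members (suc (suc zero)) (there (here refl)) = inj₂ (refl , refl)
oddFamily-members (suc (suc (suc k))) (here refl) = inj₁ refl

oddFamily-unique : ∀ k → Unique (oddFamily k)
oddFamily-unique zero = [] ∷ []
oddFamily-unique (suc zero) = [] ∷ []
oddFamily-unique (suc (suc zero)) = ((λ ()) ∷ []) ∷ ([] ∷ [])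
oddFamily-unique (suc (suc (suc k))) = [] ∷ []

double≡2⇒1 : ∀ k → double k ≡ 2 → k ≡ 1
double≡2⇒1 (suc zero) _ = refl

02143∈oddFamily : ∀ L → length L ≡ 5 → Is02143 (nth L) → L ∈ oddFamily 2
02143∈oddFamily (a ∷ b ∷ c ∷ d ∷ e ∷ []) _ (refl , refl , refl , refl , refl) = there (here refl)

odd-start : ∀ k₁ L → DAPerm (suc (double (suc k₁))) (nth L) →
        (double k₁ ≡ 2 × Is02143 (nth L)) ⊎ (nth L 0 ≡ 0 × nth L 1 ≡ 2 + double k₁)
odd-start k₁ L G with odd-second-or-02143 (double k₁) (nth L) G (even-double k₁)
... | inj₂ x = inj₁ x
... | inj₁ s1 = inj₂ (odd-max-second⇒first-0 (double k₁) (nth L) G (even-double k₁) s1 , s1)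

oddFamily-complete-step : ∀ k₂ a b c d R → length (a ∷ b ∷ c ∷ d ∷ R) ≡ suc (double (suc (suc k₂))) →
       DAPerm (suc (double (suc (suc k₂)))) (nth (a ∷ b ∷ c ∷ d ∷ R)) →
       (DAPerm (suc (double (suc k₂))) (nth (0 ∷ (2 + double k₂) ∷ R)) → (0 ∷ (2 + double k₂) ∷ R) ∈ oddFamily (suc k₂)) →
       (a ∷ b ∷ c ∷ d ∷ R) ∈ oddFamily (suc (suc k₂))
oddFamily-complete-step k₂ a b c d R len G rec with odd-start (suc k₂) (a ∷ b ∷ c ∷ d ∷ R) G
... | inj₁ (m2 , x5) with double≡2⇒1 (suc k₂) m2
...   | refl = 02143∈oddFamily _ len x5
oddFamily-complete-step k₂ a b c d R len G rec | inj₂ (s0 , s1) with odd-third-fourth (double k₂) (nth (a ∷ b ∷ c ∷ d ∷ R)) G (even-double k₂) s0 s1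
... | s2 , s3 with s0 | s1 | s2 | s3
...   | refl | refl | refl | refl = fin (oddFamily-members (suc k₂) (rec G'))
  where
  m₃ = double k₂
  L' = 0 ∷ (2 + m₃) ∷ R
  pointwise : ∀ i → peel m₃ (nth (a ∷ b ∷ c ∷ d ∷ R)) i ≡ nth L' i
  pointwise zero = refl
  pointwise (suc zero) = refl
  pointwise (suc (suc i)) = refl
  G' : DAPerm (suc (double (suc k₂))) (nth L')
  G' = DAPerm-cong pointwise (odd-peel m₃ (nth (a ∷ b ∷ c ∷ d ∷ R)) G (even-double k₂) refl refl refl refl)
  fin : L' ≡ oddDA (suc k₂) ⊎ (suc k₂ ≡ 2 × L' ≡ p02143) → (a ∷ b ∷ c ∷ d ∷ R) ∈ oddFamily (suc (suc k₂))
  fin (inj₁ e) = subst (λ z → z ∈ oddFamily (suc (suc k₂))) (cong (λ z → 0 ∷ (4 + m₃) ∷ (2 + m₃) ∷ (3 + m₃) ∷ z) (sym (cong (drop 2) e)))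
                   (oddDA∈oddFamily (suc (suc k₂)))
  fin (inj₂ (refl , ()))

oddFamily-complete : ∀ k L → length L ≡ suc (double k) → DAPerm (suc (double k)) (nth L) → L ∈ oddFamily k
oddFamily-complete zero (a ∷ []) _ G = here (cong (_∷ []) (n≤0⇒n≡0 (≤-pred (DAPerm.rng G {0} (s≤s z≤n)))))
oddFamily-complete (suc zero) (a ∷ b ∷ c ∷ []) _ G with odd-start zero (a ∷ b ∷ c ∷ []) G
... | inj₁ (() , _)
... | inj₂ (refl , refl) = here (cong (λ z → 0 ∷ 2 ∷ z ∷ []) c1)
  where
  open DA G
  c1 : c ≡ 1
  c1 = n<m<2+n⇒m≡1+n (n≢0⇒n>0 (other≢ {2} {0} (s≤s (s≤s (s≤s z≤n))) (s≤s z≤n) (λ ()) refl))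
                (m<1+n∧m≢n⇒m<n (rng {2} (s≤s (s≤s (s≤s z≤n)))) (other≢ {2} {1} (s≤s (s≤s (s≤s z≤n))) (s≤s (s≤s z≤n)) (λ ()) refl))
oddFamily-complete (suc (suc k₂)) (a ∷ b ∷ c ∷ d ∷ R) len G =
  oddFamily-complete-step k₂ a b c d R len G (λ G' → oddFamily-complete (suc k₂) (0 ∷ (2 + double k₂) ∷ R) (suc-injective (suc-injective len)) G')

injective⇒surjective : ∀ {n} (f : Fin n → Fin n) → (∀ {i j} → f i ≡ f j → i ≡ j) → ∀ v → ∃ λ i → f i ≡ v
injective⇒surjective {suc n} f f-inj v with any? (λ i → f i Fin.≟ v)
... | yes hit = hit
... | no miss = ⊥-elim (1+n≰n (injective⇒≤ {f = skip-v} (λ e → f-inj (punchOut-injective (v≢f _) (v≢f _) e))))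
  where
  v≢f : ∀ i → v ≢ f i
  v≢f i e = miss (i , sym e)
  skip-v : Fin (suc n) → Fin n
  skip-v i = punchOut (v≢f i)

chain⇒increasing : (u : ℕ → ℕ) (n : ℕ) → (∀ {c} → suc c < n → u c < u (suc c)) →
                   ∀ {a b} → a < b → b < n → u a < u b
chain⇒increasing u n step {a} {suc b} a<1+b 1+b<n with m<1+n⇒m<n∨m≡n a<1+b
... | inj₂ refl = step 1+b<n
... | inj₁ a<b = <-trans (chain⇒increasing u n step a<b (<-trans <+1 1+b<n)) (step 1+b<n)

quad : ℕ → ℕ → ℕ → ℕ → ℕ → ℕ
quad i j k l zero = i
quad i j k l (suc zero) = j
quad i j k l (suc (suc zero)) = k
quad i j k l (suc (suc (suc _))) = l

quad-step : ∀ {i j k l} → i < j → j < k → k < l → ∀ {c} → suc c < 4 → quad i j k l c < quad i j k l (suc c)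
quad-step ij jk kl {zero} _ = ij
quad-step ij jk kl {suc zero} _ = jk
quad-step ij jk kl {suc (suc zero)} _ = kl
quad-step ij jk kl {suc (suc (suc _))} (s≤s (s≤s (s≤s (s≤s ()))))

quad-< : ∀ {i j k l n} → i < j → j < k → k < l → l < n → ∀ c → quad i j k l c < n
quad-< ij jk kl ln zero = <-trans ij (<-trans jk (<-trans kl ln))
quad-< ij jk kl ln (suc zero) = <-trans jk (<-trans kl ln)
quad-< ij jk kl ln (suc (suc zero)) = <-trans kl ln
quad-< ij jk kl ln (suc (suc (suc _))) = ln

-- ρ c is the position of the value c in the pattern (0-indexed).
ρ1234 : ℕ → ℕ
ρ1234 c = c

ρ1234-lookup : ∀ a → ρ1234 (toℕ (lookup p1234 a)) ≡ toℕ a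
ρ1234-lookup Fin.zero = refl
ρ1234-lookup (Fin.suc Fin.zero) = refl
ρ1234-lookup (Fin.suc (Fin.suc Fin.zero)) = refl
ρ1234-lookup (Fin.suc (Fin.suc (Fin.suc Fin.zero))) = refl

ρ2413 : ℕ → ℕ
ρ2413 zero = 2
ρ2413 (suc zero) = 0
ρ2413 (suc (suc zero)) = 3
ρ2413 (suc (suc (suc _))) = 1

ρ2413-lookup : ∀ a → ρ2413 (toℕ (lookup p2413 a)) ≡ toℕ a
ρ2413-lookup Fin.zero = refl
ρ2413-lookup (Fin.suc Fin.zero) = refl
ρ2413-lookup (Fin.suc (Fin.suc Fin.zero)) = refl
ρ2413-lookup (Fin.suc (Fin.suc (Fin.suc Fin.zero))) = refl

toℕs : ∀ {n m} → Vec (Fin n) m → List ℕ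
toℕs v = toList (Vec.map toℕ v)

nth-toℕs : ∀ {n m} (v : Vec (Fin n) m) (i : Fin m) → nth (toℕs v) (toℕ i) ≡ toℕ (lookup v i)
nth-toℕs (x Vec.∷ v) Fin.zero = refl
nth-toℕs (x Vec.∷ v) (Fin.suc i) = nth-toℕs v i

length-toℕs : ∀ {n m} (v : Vec (Fin n) m) → length (toℕs v) ≡ m
length-toℕs Vec.[] = refl
length-toℕs (x Vec.∷ v) = cong suc (length-toℕs v)

nth-toℕs-fromℕ< : ∀ {n m} (v : Vec (Fin n) m) {i} (h : i < m) → nth (toℕs v) i ≡ toℕ (lookup v (fromℕ< h))
nth-toℕs-fromℕ< v {i} h = trans (cong (nth (toℕs v)) (sym (toℕ-fromℕ< h))) (nth-toℕs v (fromℕ< h))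

mutual
  AltUp⇒ : ∀ L → AltUp L → ∀ {i} → suc i < length L → UpDown (even i) (nth L i) (nth L (suc i))
  AltUp⇒ (x ∷ y ∷ r) (h , d) {zero} _ = h
  AltUp⇒ (x ∷ y ∷ r) (h , d) {suc i} p = subst (λ b → UpDown b (nth (y ∷ r) i) (nth (y ∷ r) (suc i))) (sym (even-suc i)) (AltDown⇒ (y ∷ r) d {i} (≤-pred p))
  AltUp⇒ [] _ ()
  AltUp⇒ (x ∷ []) _ (s≤s ())

  AltDown⇒ : ∀ L → AltDown L → ∀ {i} → suc i < length L → UpDown (not (even i)) (nth L i) (nth L (suc i))
  AltDown⇒ (x ∷ y ∷ r) (h , d) {zero} _ = h
  AltDown⇒ (x ∷ y ∷ r) (h , d) {suc i} p = subst (λ b → UpDown b (nth (y ∷ r) i) (nth (y ∷ r) (suc i)))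
      (sym (trans (cong not (even-suc i)) (not-involutive (even i)))) (AltUp⇒ (y ∷ r) d {i} (≤-pred p))
  AltDown⇒ [] _ ()
  AltDown⇒ (x ∷ []) _ (s≤s ())

mutual
  ⇒AltUp : ∀ L → (∀ {i} → suc i < length L → UpDown (even i) (nth L i) (nth L (suc i))) → AltUp L
  ⇒AltUp [] _ = tt
  ⇒AltUp (x ∷ []) _ = tt
  ⇒AltUp (x ∷ y ∷ r) h = h {0} (s≤s (s≤s z≤n)) , ⇒AltDown (y ∷ r) (λ {i} p → subst (λ b → UpDown b (nth (y ∷ r) i) (nth (y ∷ r) (suc i))) (even-suc i) (h {suc i} (s≤s p)))

  ⇒AltDown : ∀ L → (∀ {i} → suc i < length L → UpDown (not (even i)) (nth L i) (nth L (suc i))) → AltDown L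
  ⇒AltDown [] _ = tt
  ⇒AltDown (x ∷ []) _ = tt
  ⇒AltDown (x ∷ y ∷ r) h = h {0} (s≤s (s≤s z≤n)) , ⇒AltUp (y ∷ r) (λ {i} p → subst (λ b → UpDown b (nth (y ∷ r) i) (nth (y ∷ r) (suc i)))
      (trans (cong not (even-suc i)) (not-involutive (even i))) (h {suc i} (s≤s p)))

module Bridge {n : ℕ} (σ : Vec (Fin n) n) where
  s : ℕ → ℕ
  s = nth (toℕs σ)

  s≡lookup : ∀ {i} (h : i < n) → s i ≡ toℕ (lookup σ (fromℕ< h))
  s≡lookup = nth-toℕs-fromℕ< σ

  chain⇒contains : (π : Vec (Fin 4) 4) (ρ : ℕ → ℕ) → (∀ a → ρ (toℕ (lookup π a)) ≡ toℕ a) →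
    ∀ {i j k l} → i < j → j < k → k < l → l < n →
    (∀ {c} → suc c < 4 → s (quad i j k l (ρ c)) < s (quad i j k l (ρ (suc c)))) → Contains σ π
  chain⇒contains π ρ ρ-lookup {i} {j} {k} {l} ij jk kl ln chain = f , f-mono , λ a b → mk⇔ (reflect a b) (realise a b)
    where
    q : ℕ → ℕ
    q = quad i j k l
    f : Fin 4 → Fin n
    f a = fromℕ< (quad-< ij jk kl ln (toℕ a))
    v : Fin 4 → ℕ
    v a = toℕ (lookup σ (f a))
    v≡ : ∀ a → v a ≡ s (q (ρ (toℕ (lookup π a))))
    v≡ a = trans (sym (s≡lookup (quad-< ij jk kl ln (toℕ a)))) (cong (s ∘ q) (sym (ρ-lookup a)))
    f-mono : ∀ a b → a Fin.< b → f a Fin.< f b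
    f-mono a b a<b = subst₂ _<_ (sym (toℕ-fromℕ< _)) (sym (toℕ-fromℕ< _))
      (chain⇒increasing q 4 (quad-step ij jk kl) a<b (toℕ<n b))
    realise : ∀ a b → lookup π a Fin.< lookup π b → v a < v b
    realise a b πa<πb = subst₂ _<_ (sym (v≡ a)) (sym (v≡ b))
      (chain⇒increasing (s ∘ q ∘ ρ) 4 chain πa<πb (toℕ<n (lookup π b)))
    reflect : ∀ a b → v a < v b → lookup π a Fin.< lookup π b
    reflect a b va<vb with <-cmp (toℕ (lookup π a)) (toℕ (lookup π b))
    ... | tri< lt _ _ = lt
    ... | tri≈ _ e _ = ⊥-elim (<-irrefl (cong v (toℕ-injective (trans (sym (ρ-lookup a)) (trans (cong ρ e) (ρ-lookup b))))) va<vb)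
    ... | tri> _ _ gt = ⊥-elim (<-asym va<vb (realise b a gt))

  contains⇒order : ∀ {π : Vec (Fin 4) 4} (c : Contains σ π) →
                   ∀ a b → lookup π a Fin.< lookup π b → s (toℕ (proj₁ c a)) < s (toℕ (proj₁ c b))
  contains⇒order (f , _ , iff) a b h = subst₂ _<_ (sym (nth-toℕs σ (f a))) (sym (nth-toℕs σ (f b))) (Equivalence.from (iff a b) h)

  InDA⇒DAPerm : InDA σ → DAPerm n s
  InDA⇒DAPerm (perm , (altσ , (w , inv , altw)) , av1234 , av2413) = record
    { rng = rngF ; inj = injF ; sur = surF ; alt = altF ; alt⁻¹ = alt⁻¹F ; avoid = avoidF }
    where
    rngF : ∀ {i} → i < n → s i < n
    rngF {i} h = subst (_< n) (sym (s≡lookup h)) (toℕ<n _)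
    injF : ∀ {i j} → i < n → j < n → s i ≡ s j → i ≡ j
    injF {i} {j} hi hj e = trans (sym (toℕ-fromℕ< hi)) (trans (cong toℕ (perm (fromℕ< hi) (fromℕ< hj)
        (toℕ-injective (trans (sym (s≡lookup hi)) (trans e (s≡lookup hj)))))) (toℕ-fromℕ< hj))
    surF : ∀ {v} → v < n → ∃ λ i → i < n × s i ≡ v
    surF v<n with injective⇒surjective (lookup σ) (perm _ _) (fromℕ< v<n)
    ... | i , σi≡v = toℕ i , toℕ<n i , trans (nth-toℕs σ i) (trans (cong toℕ σi≡v) (toℕ-fromℕ< v<n))
    altF : ∀ {i} → suc i < n → UpDown (even i) (s i) (s (suc i))
    altF {i} h = AltUp⇒ (toℕs σ) altσ (subst (suc i <_) (sym (length-toℕs σ)) h)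
    w-position : ∀ {i v} (h : i < n) (vn : v < n) → s i ≡ v → nth (toℕs w) v ≡ i
    w-position {i} {v} h vn e = trans (nth-toℕs-fromℕ< w vn)
      (trans (cong (λ z → toℕ (lookup w z)) fe) (trans (cong toℕ (inv (fromℕ< h))) (toℕ-fromℕ< h)))
      where
      fe : fromℕ< vn ≡ lookup σ (fromℕ< h)
      fe = toℕ-injective (trans (toℕ-fromℕ< vn) (trans (sym e) (s≡lookup h)))
    alt⁻¹F : ∀ {i j} → i < n → j < n → s j ≡ suc (s i) → UpDown (even (s i)) i j
    alt⁻¹F {i} {j} hi hj e = subst₂ (UpDown (even (s i))) (w-position hi vn refl) (w-position hj svn e)
        (AltUp⇒ (toℕs w) altw (subst (suc (s i) <_) (sym (length-toℕs w)) svn))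
      where
      svn : suc (s i) < n
      svn = subst (_< n) e (rngF hj)
      vn : s i < n
      vn = <-trans <+1 svn
    avoidF : AvoidsBoth n s
    avoidF ij jk kl ln (inj₁ (x , y , z)) = av1234 (chain⇒contains p1234 ρ1234 ρ1234-lookup ij jk kl ln chain)
      where
      chain : ∀ {c} → suc c < 4 → _
      chain {zero} _ = x
      chain {suc zero} _ = y
      chain {suc (suc zero)} _ = z
      chain {suc (suc (suc _))} (s≤s (s≤s (s≤s (s≤s ()))))
    avoidF ij jk kl ln (inj₂ (x , y , z)) = av2413 (chain⇒contains p2413 ρ2413 ρ2413-lookup ij jk kl ln chain)
      where
      chain : ∀ {c} → suc c < 4 → _
      chain {zero} _ = x
      chain {suc zero} _ = y
      chain {suc (suc zero)} _ = z
      chain {suc (suc (suc _))} (s≤s (s≤s (s≤s (s≤s ()))))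

  DAPerm⇒InDA : DAPerm n s → InDA σ
  DAPerm⇒InDA G = perm , (altσ , (w , inv , altw)) , av1234 , av2413
    where
    open DA G
    perm : IsPerm σ
    perm i j e = toℕ-injective (inj (toℕ<n i) (toℕ<n j) (trans (nth-toℕs σ i) (trans (cong toℕ e) (sym (nth-toℕs σ j)))))
    altσ : Alternating σ
    altσ = ⇒AltUp (toℕs σ) (λ p → alt (subst (_ <_) (length-toℕs σ) p))
    w : Vec (Fin n) n
    w = tabulate (λ u → fromℕ< (proj₁ (position-spec (toℕ<n u))))
    nth-w : ∀ {v} (vn : v < n) → nth (toℕs w) v ≡ position v
    nth-w {v} vn = trans (nth-toℕs-fromℕ< w vn) (trans (cong toℕ (lookup∘tabulate _ (fromℕ< vn)))
                 (trans (toℕ-fromℕ< _) (cong position (toℕ-fromℕ< vn))))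
    inv : IsInverse σ w
    inv i = toℕ-injective (trans (cong toℕ (lookup∘tabulate _ (lookup σ i))) (trans (toℕ-fromℕ< _)
              (inj (proj₁ (position-spec (toℕ<n (lookup σ i)))) (toℕ<n i)
                   (trans (proj₂ (position-spec (toℕ<n (lookup σ i)))) (sym (nth-toℕs σ i))))))
    altw : Alternating w
    altw = ⇒AltUp (toℕs w) λ {v} p → w-step v (subst (_ <_) (length-toℕs w) p)
      where
      w-step : ∀ v → suc v < n → UpDown (even v) (nth (toℕs w) v) (nth (toℕs w) (suc v))
      w-step v svn = subst₂ (UpDown (even v)) (sym (nth-w vn)) (sym (nth-w svn))
          (subst (λ z → UpDown (even z) (position v) (position (suc v))) (proj₂ (position-spec vn))
            (alt⁻¹ (proj₁ (position-spec vn)) (proj₁ (position-spec svn))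
                   (trans (proj₂ (position-spec svn)) (cong suc (sym (proj₂ (position-spec vn)))))))
        where
        vn : v < n
        vn = <-trans <+1 svn
    av1234 : Avoids σ p1234
    av1234 c@(f , mono , _) = avoid (mono (# 0) (# 1) (s≤s z≤n)) (mono (# 1) (# 2) (s≤s (s≤s z≤n))) (mono (# 2) (# 3) (s≤s (s≤s (s≤s z≤n)))) (toℕ<n (f (# 3)))
      (inj₁ (order (# 0) (# 1) (s≤s z≤n) , order (# 1) (# 2) (s≤s (s≤s z≤n)) , order (# 2) (# 3) (s≤s (s≤s (s≤s z≤n)))))
      where order = contains⇒order {π = p1234} c
    av2413 : Avoids σ p2413
    av2413 c@(f , mono , _) = avoid (mono (# 0) (# 1) (s≤s z≤n)) (mono (# 1) (# 2) (s≤s (s≤s z≤n))) (mono (# 2) (# 3) (s≤s (s≤s (s≤s z≤n)))) (toℕ<n (f (# 3)))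
      (inj₂ (order (# 2) (# 0) (s≤s z≤n) , order (# 0) (# 3) (s≤s (s≤s z≤n)) , order (# 3) (# 1) (s≤s (s≤s (s≤s z≤n)))))
      where order = contains⇒order {π = p2413} c

double≡*2 : ∀ j → double j ≡ j * 2
double≡*2 zero = refl
double≡*2 (suc j) = cong (2 +_) (double≡*2 j)

expected-even : ∀ j → expected (double j) ≡ F j
expected-even j = trans (cong expected (double≡*2 j)) (halve j)
  where
  [j*2]%2≡0 : ∀ j → j * 2 % 2 ≡ 0
  [j*2]%2≡0 j = m*n%n≡0 j 2
  [j*2]/2≡j : ∀ j → j * 2 / 2 ≡ j
  [j*2]/2≡j j = m*n/n≡m j 2
  halve : ∀ j → expected (j * 2) ≡ F j
  halve j rewrite [j*2]%2≡0 j | [j*2]/2≡j j = refl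

expected-odd : ∀ j → expected (suc (double j)) ≡ length (oddFamily j)
expected-odd j = trans (cong (expected ∘ suc) (double≡*2 j)) (trans (odd j) (count j))
  where
  [1+j*2]%2≡1 : ∀ j → suc (j * 2) % 2 ≡ 1
  [1+j*2]%2≡1 j = [m+kn]%n≡m%n 1 j 2
  odd : ∀ j → expected (suc (j * 2)) ≡ (if suc (j * 2) ≡ᵇ 5 then 2 else 1)
  odd j rewrite [1+j*2]%2≡1 j = refl
  count : ∀ j → (if suc (j * 2) ≡ᵇ 5 then 2 else 1) ≡ length (oddFamily j)
  count zero = refl
  count (suc zero) = refl
  count (suc (suc zero)) = refl
  count (suc (suc (suc j))) = refl

-- Out-of-range entries are clamped to the junk value zero.
clampFin : ∀ k → ℕ → Fin (suc k)
clampFin k v with v <? suc k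
... | yes h = fromℕ< h
... | no _ = Fin.zero

toℕ-clampFin : ∀ k {v} → v < suc k → toℕ (clampFin k v) ≡ v
toℕ-clampFin k {v} h with v <? suc k
... | yes h' = toℕ-fromℕ< h'
... | no ¬h = ⊥-elim (¬h h)

fromℕs : ∀ k → List ℕ → Vec (Fin (suc k)) (suc k)
fromℕs k xs = tabulate (λ i → clampFin k (nth xs (toℕ i)))

nth-extensionality : ∀ (xs ys : List ℕ) → length xs ≡ length ys → (∀ i → i < length xs → nth xs i ≡ nth ys i) → xs ≡ ys
nth-extensionality [] [] _ _ = refl
nth-extensionality (x ∷ xs) (y ∷ ys) e h =
  cong₂ _∷_ (h 0 (s≤s z≤n)) (nth-extensionality xs ys (suc-injective e) (λ i p → h (suc i) (s≤s p)))

toℕs-fromℕs : ∀ k (xs : List ℕ) → length xs ≡ suc k → (∀ {i} → i < suc k → nth xs i < suc k) → toℕs (fromℕs k xs) ≡ xs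
toℕs-fromℕs k xs len bounded = nth-extensionality _ _ (trans (length-toℕs (fromℕs k xs)) (sym len)) pointwise
  where
  pointwise : ∀ i → i < length (toℕs (fromℕs k xs)) → nth (toℕs (fromℕs k xs)) i ≡ nth xs i
  pointwise i p = begin
      nth (toℕs (fromℕs k xs)) i                          ≡⟨ nth-toℕs-fromℕ< (fromℕs k xs) h ⟩
      toℕ (lookup (fromℕs k xs) (fromℕ< h))               ≡⟨ cong toℕ (lookup∘tabulate (λ i → clampFin k (nth xs (toℕ i))) (fromℕ< h)) ⟩
      toℕ (clampFin k (nth xs (toℕ (fromℕ< {i} h))))      ≡⟨ cong (λ z → toℕ (clampFin k (nth xs z))) (toℕ-fromℕ< h) ⟩
      toℕ (clampFin k (nth xs i))                         ≡⟨ toℕ-clampFin k (bounded h) ⟩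
      nth xs i                                            ∎
    where
    open ≡-Reasoning
    h : i < suc k
    h = subst (i <_) (length-toℕs (fromℕs k xs)) p

fromℕs-toℕs : ∀ k (σ : Vec (Fin (suc k)) (suc k)) → fromℕs k (toℕs σ) ≡ σ
fromℕs-toℕs k σ = trans (tabulate-cong λ i → toℕ-injective
  (trans (cong (λ z → toℕ (clampFin k z)) (nth-toℕs σ i)) (toℕ-clampFin k (toℕ<n (lookup σ i))))) (tabulate∘lookup σ)

record Enumerates (k : ℕ) (family : List (List ℕ)) : Set where
  field
    sound    : ∀ {xs} → xs ∈ family → length xs ≡ suc k × DAPerm (suc k) (nth xs)
    complete : ∀ xs → length xs ≡ suc k → DAPerm (suc k) (nth xs) → xs ∈ family
    unique   : Unique family

enumeration : ∀ {k family} → Enumerates k family →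
  ∃ λ (σs : List (Vec (Fin (suc k)) (suc k))) → Unique σs × (∀ σ → (σ ∈ σs) ⇔ InDA σ) × (length σs ≡ length family)
enumeration {k} {family} E = map (fromℕs k) family , unique-σs , (λ σ → mk⇔ (listed⇒InDA σ) (InDA⇒listed σ)) , length-map (fromℕs k) family
  where
  open Enumerates E
  round-trip : ∀ {xs} → xs ∈ family → toℕs (fromℕs k xs) ≡ xs
  round-trip m = toℕs-fromℕs k _ (proj₁ (sound m)) (DAPerm.rng (proj₂ (sound m)))
  map-round-trip : ∀ ys → (∀ {xs} → xs ∈ ys → toℕs (fromℕs k xs) ≡ xs) → map toℕs (map (fromℕs k) ys) ≡ ys
  map-round-trip [] _ = refl
  map-round-trip (y ∷ ys) h = cong₂ _∷_ (h (here refl)) (map-round-trip ys (λ m → h (there m)))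
  unique-σs : Unique (map (fromℕs k) family)
  unique-σs = Unique.map⁻ (subst Unique (sym (map-round-trip family round-trip)) unique)
  listed⇒InDA : ∀ σ → σ ∈ map (fromℕs k) family → InDA σ
  listed⇒InDA σ m with ∈-map⁻ (fromℕs k) m
  ... | xs , m′ , refl = Bridge.DAPerm⇒InDA (fromℕs k xs) (subst (λ z → DAPerm (suc k) (nth z)) (sym (round-trip m′)) (proj₂ (sound m′)))
  InDA⇒listed : ∀ σ → InDA σ → σ ∈ map (fromℕs k) family
  InDA⇒listed σ d = subst (_∈ map (fromℕs k) family) (fromℕs-toℕs k σ)
    (∈-map⁺ (fromℕs k) (complete (toℕs σ) (length-toℕs σ) (Bridge.InDA⇒DAPerm σ d)))

evenFamily-enumerates : ∀ j → Enumerates (suc (double j)) (evenFamily (suc j))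
evenFamily-enumerates j = record
  { sound = evenFamily-sound (suc j) ; complete = evenFamily-complete (suc j) ; unique = evenFamily-unique (suc j) }

oddFamily-enumerates : ∀ j → Enumerates (double j) (oddFamily j)
oddFamily-enumerates j = record { sound = oddFamily-sound j ; complete = oddFamily-complete j ; unique = oddFamily-unique j }

data ParityView : ℕ → Set where
  even-view : ∀ j → ParityView (double j)
  odd-view  : ∀ j → ParityView (suc (double j))

parityView : ∀ n → ParityView n
parityView zero = even-view 0
parityView (suc n) with parityView n
... | even-view j = odd-view j
... | odd-view j = even-view (suc j)

proposition8p1 : (n : ℕ) → 1 ≤ n →
    ∃ λ (xs : List (Vec (Fin n) n)) →
      Unique xs × (∀ σ → (σ ∈ xs) ⇔ InDA σ) × (length xs ≡ expected n)
proposition8p1 n 1≤n with parityView n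
... | even-view zero with () ← 1≤n
... | even-view (suc j) with σs , unique , listsDA , len ← enumeration (evenFamily-enumerates j) =
  σs , unique , listsDA , trans len (trans (length-evenFamily (suc j)) (sym (expected-even (suc j))))
... | odd-view j with σs , unique , listsDA , len ← enumeration (oddFamily-enumerates j) =
  σs , unique , listsDA , trans len (sym (expected-odd j))
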